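{- Let $p_r(n)$ denote Ramanujan's general partition function, defined for integers $n\ge 0$ and nonzero integers $r$ by $\sum_{n=0}^\infty p_r(n)q^n=\frac{1}{(q;q)_\infty^r}$ for $|q|<1$, where $(q;q)_\infty=\prod_{k=1}^\infty(1-q^{k})$. For any integer $\lambda$, every integer $n\ge 0$, and $\ell\in\{2,3,4\}$, we have $p_{ -(5\lambda+3)}(5n+\ell)\equiv 0\pmod 5$. -}

module Defs where

open import Data.Nat as ℕ using (ℕ; zero; suc)
open import Data.Nat.Divisibility using (_∣?_)
open import Data.Integer using (ℤ; +_; -[1+_]; _+_; _*_; -_; 0ℤ; 1ℤ)
open import Data.List using (List; foldr; map; upTo)
open import Data.Bool using (if_then_else_)
open import Relation.Nullary.Decidable using (⌊_⌋)

Series : Set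
Series = ℕ → ℤ

one : Series
one zero    = 1ℤ
one (suc _) = 0ℤ

_⊛_ : Series → Series → Series
(a ⊛ b) n = foldr _+_ 0ℤ (map (λ i → a i * b (n ℕ.∸ i)) (upTo (suc n)))

infixl 7 _⊛_

_^ₛ_ : Series → ℕ → Series
a ^ₛ zero  = one
a ^ₛ suc m = a ⊛ (a ^ₛ m)

prodUpTo : (ℕ → Series) → ℕ → Series
prodUpTo f zero    = one
prodUpTo f (suc N) = prodUpTo f N ⊛ f (suc N)

-- The factor 1 - q^k (for k ≥ 1).
eulerFactor : ℕ → Series
eulerFactor k zero = 1ℤ
eulerFactor k (suc j) = if ⌊ k ℕ.≟ suc j ⌋ then - 1ℤ else 0ℤ

-- The factor 1/(1 - q^k) = Σ_{j ≥ 0} q^{k j}  (for k ≥ 1).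
geomFactor : ℕ → Series
geomFactor k j = if ⌊ k ∣? j ⌋ then 1ℤ else 0ℤ

-- (q;q)_∞ = ∏_{k≥1} (1 - q^k): truncating the product at k ≤ N does not
-- change coefficients of q^n for n ≤ N; likewise for 1/(q;q)_∞.
eulerTrunc : ℕ → Series
eulerTrunc = prodUpTo eulerFactor

partTrunc : ℕ → Series
partTrunc = prodUpTo geomFactor

-- For r = m ≥ 0 this is (1/(q;q)_∞)^m, for r = -(m+1) it is (q;q)_∞^(m+1).
-- The coefficient of q^n is computed from products truncated at k ≤ n (exact).
p : ℤ → ℕ → ℤ
p (+ m)      n = (partTrunc n ^ₛ m) n
p -[1+ m ]   n = (eulerTrunc n ^ₛ suc m) n

module Submission where

-- For λ = μ ≥ 0 the generating series of p_{-(5λ+3)} is (q;q)^(5μ+3), for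
-- λ = -(μ+1) it is 1/(q;q)^(5μ+2).  Modulo 5 the Frobenius identity
-- (1-x)^5 ≡ 1-x^5 gives (q;q)^5 ≡ (q^5;q^5), so both series are a series in q^5
-- times (q;q)^3.  By Jacobi's identity 2(q;q)^3 = Σ_{k∈ℤ} (2k+1)(-1)^k q^(k(k+1)/2),
-- and k(k+1)/2 ≡ 2, 3, 4 (mod 5) forces k ≡ 2, i.e. 5 | 2k+1.  So (q;q)^3 has
-- no terms q^i with i ≡ 2, 3, 4 (mod 5) modulo 5, and multiplying by a series
-- in q^5 keeps this property.

open import Defs
open import Level using (0ℓ)
open import Data.Nat as ℕ using (ℕ; zero; suc; z≤n; s≤s; _≤_; _<_; _%_)
import Data.Nat.Properties as ℕP
open import Data.Integer as ℤ using (ℤ; +_; -[1+_]; _+_; _*_; -_; 0ℤ; 1ℤ; _-_)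
import Data.Integer.Properties as ℤP
open import Data.Integer.Divisibility using (_∣_)
open import Data.Nat using () renaming (_+_ to _+ℕ_; _*_ to _*ℕ_)
open import Data.Integer using () renaming (_+_ to _+ℤ_; _*_ to _*ℤ_)
open import Data.Integer.Divisibility.Signed as Signed using (divides; ∣m∣n⇒∣m+n; ∣m⇒∣-m; ∣n⇒∣m*n; ∣m⇒∣m*n)
  renaming (_∣_ to _∣ˢ_)
open import Data.Integer.Tactic.RingSolver using (solve-∀)
open import Data.List using (foldr; map; applyUpTo)
open import Data.List.Properties using (map-applyUpTo)
open import Relation.Binary.PropositionalEquality as P using (_≡_; _≢_; refl; cong; cong₂; sym; trans; subst)
open import Function using (_∘_; id)
open import Data.Product using (_×_; _,_; proj₂)
open import Data.Maybe using (Maybe; just; nothing)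
open import Relation.Nullary using (Dec; yes; no)
open import Data.Empty using (⊥-elim)
open import Data.Nat.Divisibility as ℕD using (_∣?_)
open import Relation.Binary.Bundles using (Setoid)
open import Relation.Binary.Structures using (IsEquivalence)
open import Algebra.Bundles using (CommutativeRing)
open import Algebra.Structures using (IsCommutativeRing)
open import Algebra.Consequences.Setoid using (comm∧idˡ⇒id; comm∧distrʳ⇒distr)
open import Algebra.Solver.Ring.AlmostCommutativeRing using (fromCommutativeRing; _-Raw-AlmostCommutative⟶_)
import Algebra.Solver.Ring
import Data.Nat.Tactic.RingSolver as ℕSolver
open import Data.Nat.DivMod using ([m+kn]%n≡m%n; m*n≤o⇒[o∸m*n]%n≡o%n; m<n⇒m%n≡m)
import Algebra.Properties.CommutativeSemiring.Exp

-- Congruence of integers modulo d (a record, so that a, b, d can be inferred).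

infix 4 _≡_[mod_]
record _≡_[mod_] (a b d : ℤ) : Set where
  constructor congruent
  field divides-difference : d ∣ˢ (a - b)
open _≡_[mod_]

module _ {d : ℤ} where

  private
    ∣-by : ∀ {x y} → x ≡ y → d ∣ˢ y → d ∣ˢ x
    ∣-by e = subst (d ∣ˢ_) (sym e)

  ≡⇒≡mod : ∀ {a b} → a ≡ b → a ≡ b [mod d ]
  ≡⇒≡mod {a} refl = congruent (divides 0ℤ (trans (ℤP.+-inverseʳ a) (sym (ℤP.*-zeroˡ d))))

  mod-refl : ∀ {a} → a ≡ a [mod d ]
  mod-refl {a} = ≡⇒≡mod {a} refl

  mod-sym : ∀ {a b} → a ≡ b [mod d ] → b ≡ a [mod d ]
  mod-sym {a} {b} (congruent h) = congruent (∣-by (lemma a b) (∣m⇒∣-m h))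
    where lemma : ∀ a b → b - a ≡ - (a - b)
          lemma = solve-∀

  mod-trans : ∀ {a b c} → a ≡ b [mod d ] → b ≡ c [mod d ] → a ≡ c [mod d ]
  mod-trans {a} {b} {c} (congruent h) (congruent k) = congruent (∣-by (lemma a b c) (∣m∣n⇒∣m+n h k))
    where lemma : ∀ a b c → a - c ≡ (a - b) + (b - c)
          lemma = solve-∀

  mod-+ : ∀ {a b c e} → a ≡ b [mod d ] → c ≡ e [mod d ] → a + c ≡ b + e [mod d ]
  mod-+ {a} {b} {c} {e} (congruent h) (congruent k) = congruent (∣-by (lemma a b c e) (∣m∣n⇒∣m+n h k))
    where lemma : ∀ a b c e → (a + c) - (b + e) ≡ (a - b) + (c - e)
          lemma = solve-∀

  mod-* : ∀ {a b c e} → a ≡ b [mod d ] → c ≡ e [mod d ] → a * c ≡ b * e [mod d ]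
  mod-* {a} {b} {c} {e} (congruent h) (congruent k) =
    congruent (∣-by (lemma a b c e) (∣m∣n⇒∣m+n (∣n⇒∣m*n a k) (∣m⇒∣m*n e h)))
    where lemma : ∀ a b c e → a * c - b * e ≡ a * (c - e) + (a - b) * e
          lemma = solve-∀

  mod-neg : ∀ {a b} → a ≡ b [mod d ] → - a ≡ - b [mod d ]
  mod-neg {a} {b} (congruent h) = congruent (∣-by (lemma a b) (∣m⇒∣-m h))
    where lemma : ∀ a b → - a - - b ≡ - (a - b)
          lemma = solve-∀

tail : Series → Series
tail a n = a (suc n)

conv-suc : ∀ a b n → (a ⊛ b) (suc n) ≡ a 0 * b (suc n) + (tail a ⊛ b) n
conv-suc a b n = cong (_+_ (a 0 * b (suc n))) (cong (foldr _+_ 0ℤ)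
  (trans (map-applyUpTo suc (λ i → a i * b (suc n ℕ.∸ i)) (suc n))
         (sym (map-applyUpTo id (λ i → a (suc i) * b (n ℕ.∸ i)) (suc n)))))

infixl 6 _+ₛ_ _-ₛ_
infixl 7 _·_
infix 8 -ₛ_

_+ₛ_ : Series → Series → Series
(a +ₛ b) n = a n + b n

-ₛ_ : Series → Series
(-ₛ a) n = - a n

_-ₛ_ : Series → Series → Series
a -ₛ b = a +ₛ (-ₛ b)

0ₛ : Series
0ₛ n = 0ℤ

_·_ : ℤ → Series → Series
(c · a) n = c * a n

module _ where
  open P.≡-Reasoning

  conv-cong : ∀ {a a′ b b′} → (∀ i → a i ≡ a′ i) → (∀ i → b i ≡ b′ i) →
              ∀ n → (a ⊛ b) n ≡ (a′ ⊛ b′) n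
  conv-cong ea eb zero = cong₂ (λ x y → x * y + 0ℤ) (ea 0) (eb 0)
  conv-cong {a} {a′} {b} {b′} ea eb (suc n) = begin
    (a ⊛ b) (suc n)                      ≡⟨ conv-suc a b n ⟩
    a 0 * b (suc n) + (tail a ⊛ b) n     ≡⟨ cong₂ _+_ (cong₂ _*_ (ea 0) (eb (suc n))) (conv-cong (ea ∘ suc) eb n) ⟩
    a′ 0 * b′ (suc n) + (tail a′ ⊛ b′) n ≡⟨ sym (conv-suc a′ b′ n) ⟩
    (a′ ⊛ b′) (suc n)                    ∎

  conv-zeroˡ : ∀ b n → (0ₛ ⊛ b) n ≡ 0ℤ
  conv-zeroˡ b zero    = refl
  conv-zeroˡ b (suc n) = trans (conv-suc 0ₛ b n) (trans (ℤP.+-identityˡ _) (conv-zeroˡ b n))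

  conv-oneˡ : ∀ b n → (one ⊛ b) n ≡ b n
  conv-oneˡ b zero    = trans (ℤP.+-identityʳ _) (ℤP.*-identityˡ (b 0))
  conv-oneˡ b (suc n) = begin
    (one ⊛ b) (suc n)                ≡⟨ conv-suc one b n ⟩
    1ℤ * b (suc n) + (0ₛ ⊛ b) n      ≡⟨ cong₂ _+_ (ℤP.*-identityˡ (b (suc n))) (conv-zeroˡ b n) ⟩
    b (suc n) + 0ℤ                   ≡⟨ ℤP.+-identityʳ _ ⟩
    b (suc n)                        ∎

  conv-distribʳ : ∀ a a′ b n → ((a +ₛ a′) ⊛ b) n ≡ (a ⊛ b) n + (a′ ⊛ b) n
  conv-distribʳ a a′ b zero = lemma (a 0) (a′ 0) (b 0)
    where lemma : ∀ x y z → (x + y) * z + 0ℤ ≡ (x * z + 0ℤ) + (y * z + 0ℤ)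
          lemma = solve-∀
  conv-distribʳ a a′ b (suc n) = begin
    ((a +ₛ a′) ⊛ b) (suc n)
      ≡⟨ conv-suc (a +ₛ a′) b n ⟩
    (a 0 + a′ 0) * b (suc n) + ((tail a +ₛ tail a′) ⊛ b) n
      ≡⟨ cong (_+_ ((a 0 + a′ 0) * b (suc n))) (conv-distribʳ (tail a) (tail a′) b n) ⟩
    (a 0 + a′ 0) * b (suc n) + ((tail a ⊛ b) n + (tail a′ ⊛ b) n)
      ≡⟨ lemma (a 0) (a′ 0) (b (suc n)) _ _ ⟩
    (a 0 * b (suc n) + (tail a ⊛ b) n) + (a′ 0 * b (suc n) + (tail a′ ⊛ b) n)
      ≡⟨ sym (cong₂ _+_ (conv-suc a b n) (conv-suc a′ b n)) ⟩
    (a ⊛ b) (suc n) + (a′ ⊛ b) (suc n) ∎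
    where lemma : ∀ x y z u v → (x + y) * z + (u + v) ≡ (x * z + u) + (y * z + v)
          lemma = solve-∀

  conv-scalˡ : ∀ c a b n → ((c · a) ⊛ b) n ≡ c * (a ⊛ b) n
  conv-scalˡ c a b zero = lemma c (a 0) (b 0)
    where lemma : ∀ x y z → (x * y) * z + 0ℤ ≡ x * (y * z + 0ℤ)
          lemma = solve-∀
  conv-scalˡ c a b (suc n) = begin
    ((c · a) ⊛ b) (suc n)                      ≡⟨ conv-suc (c · a) b n ⟩
    (c * a 0) * b (suc n) + ((c · tail a) ⊛ b) n ≡⟨ cong (_+_ ((c * a 0) * b (suc n))) (conv-scalˡ c (tail a) b n) ⟩
    (c * a 0) * b (suc n) + c * (tail a ⊛ b) n   ≡⟨ lemma c (a 0) (b (suc n)) _ ⟩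
    c * (a 0 * b (suc n) + (tail a ⊛ b) n)       ≡⟨ sym (cong (c *_) (conv-suc a b n)) ⟩
    c * (a ⊛ b) (suc n)                          ∎
    where lemma : ∀ x y z u → (x * y) * z + x * u ≡ x * (y * z + u)
          lemma = solve-∀

  conv-suc′ : ∀ a b n → (a ⊛ b) (suc n) ≡ (a ⊛ tail b) n + a (suc n) * b 0
  conv-suc′ a b zero = lemma (a 0) (b 1) (a 1) (b 0)
    where lemma : ∀ x y z u → x * y + (z * u + 0ℤ) ≡ (x * y + 0ℤ) + z * u
          lemma = solve-∀
  conv-suc′ a b (suc n) = begin
    (a ⊛ b) (suc (suc n))
      ≡⟨ conv-suc a b (suc n) ⟩
    a 0 * b (suc (suc n)) + (tail a ⊛ b) (suc n)
      ≡⟨ cong (_+_ (a 0 * b (suc (suc n)))) (conv-suc′ (tail a) b n) ⟩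
    a 0 * b (suc (suc n)) + ((tail a ⊛ tail b) n + a (suc (suc n)) * b 0)
      ≡⟨ sym (ℤP.+-assoc (a 0 * b (suc (suc n))) _ _) ⟩
    (a 0 * b (suc (suc n)) + (tail a ⊛ tail b) n) + a (suc (suc n)) * b 0
      ≡⟨ cong (_+ (a (suc (suc n)) * b 0)) (sym (conv-suc a (tail b) n)) ⟩
    (a ⊛ tail b) (suc n) + a (suc (suc n)) * b 0 ∎

  conv-comm : ∀ a b n → (a ⊛ b) n ≡ (b ⊛ a) n
  conv-comm a b zero = cong (_+ 0ℤ) (ℤP.*-comm (a 0) (b 0))
  conv-comm a b (suc n) = begin
    (a ⊛ b) (suc n)                  ≡⟨ conv-suc a b n ⟩
    a 0 * b (suc n) + (tail a ⊛ b) n ≡⟨ cong (_+_ (a 0 * b (suc n))) (conv-comm (tail a) b n) ⟩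
    a 0 * b (suc n) + (b ⊛ tail a) n ≡⟨ ℤP.+-comm (a 0 * b (suc n)) _ ⟩
    (b ⊛ tail a) n + a 0 * b (suc n) ≡⟨ cong (_+_ ((b ⊛ tail a) n)) (ℤP.*-comm (a 0) (b (suc n))) ⟩
    (b ⊛ tail a) n + b (suc n) * a 0 ≡⟨ sym (conv-suc′ b a n) ⟩
    (b ⊛ a) (suc n)                  ∎

  conv-assoc : ∀ a b c n → ((a ⊛ b) ⊛ c) n ≡ (a ⊛ (b ⊛ c)) n
  conv-assoc a b c zero = lemma (a 0) (b 0) (c 0)
    where lemma : ∀ x y z → (x * y + 0ℤ) * z + 0ℤ ≡ x * (y * z + 0ℤ) + 0ℤ
          lemma = solve-∀
  conv-assoc a b c (suc n) = begin
    ((a ⊛ b) ⊛ c) (suc n)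
      ≡⟨ conv-suc (a ⊛ b) c n ⟩
    ab₀ * c (suc n) + (tail (a ⊛ b) ⊛ c) n
      ≡⟨ cong (_+_ (ab₀ * c (suc n))) (conv-cong {b = c} (conv-suc a b) (λ _ → refl) n) ⟩
    ab₀ * c (suc n) + (((a 0 · tail b) +ₛ (tail a ⊛ b)) ⊛ c) n
      ≡⟨ cong (_+_ (ab₀ * c (suc n))) (conv-distribʳ (a 0 · tail b) (tail a ⊛ b) c n) ⟩
    ab₀ * c (suc n) + (((a 0 · tail b) ⊛ c) n + ((tail a ⊛ b) ⊛ c) n)
      ≡⟨ cong₂ (λ x y → ab₀ * c (suc n) + (x + y)) (conv-scalˡ (a 0) (tail b) c n) (conv-assoc (tail a) b c n) ⟩
    ab₀ * c (suc n) + (a 0 * (tail b ⊛ c) n + (tail a ⊛ (b ⊛ c)) n)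
      ≡⟨ lemma (a 0) (b 0) (c (suc n)) _ _ ⟩
    a 0 * (b 0 * c (suc n) + (tail b ⊛ c) n) + (tail a ⊛ (b ⊛ c)) n
      ≡⟨ cong (λ x → a 0 * x + (tail a ⊛ (b ⊛ c)) n) (sym (conv-suc b c n)) ⟩
    a 0 * (b ⊛ c) (suc n) + (tail a ⊛ (b ⊛ c)) n
      ≡⟨ sym (conv-suc a (b ⊛ c) n) ⟩
    (a ⊛ (b ⊛ c)) (suc n) ∎
    where
    ab₀ : ℤ
    ab₀ = a 0 * b 0 + 0ℤ
    lemma : ∀ x y z u v → (x * y + 0ℤ) * z + (x * u + v) ≡ x * (y * z + u) + v
    lemma = solve-∀

κ : ℤ → Series
κ c zero    = c
κ c (suc n) = 0ℤ

κ-conv : ∀ c g n → (κ c ⊛ g) n ≡ c * g n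
κ-conv c g n = trans (conv-cong {κ c} {c · one} {g} (λ { zero → sym (ℤP.*-identityʳ c) ; (suc i) → sym (ℤP.*-zeroʳ c) }) (λ _ → refl) n)
                     (trans (conv-scalˡ c one g n) (cong (c *_) (conv-oneˡ g n)))

infix 9 q^_
q^_ : ℕ → Series
q^ zero              = one
(q^ suc k) zero      = 0ℤ
(q^ suc k) (suc n)   = (q^ k) n

shift : ℕ → Series → Series
shift zero    g         = g
shift (suc k) g zero    = 0ℤ
shift (suc k) g (suc n) = shift k g n

mono-conv : ∀ k g n → (q^ k ⊛ g) n ≡ shift k g n
mono-conv zero    g n       = conv-oneˡ g n
mono-conv (suc k) g zero    = refl
mono-conv (suc k) g (suc n) =
  trans (conv-suc (q^ suc k) g n) (trans (ℤP.+-identityˡ _) (mono-conv k g n))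

shift-mono : ∀ k j n → shift k (q^ j) n ≡ (q^ (k ℕ.+ j)) n
shift-mono zero    j n       = refl
shift-mono (suc k) j zero    = refl
shift-mono (suc k) j (suc n) = shift-mono k j n

shift-below : ∀ k g n → n < k → shift k g n ≡ 0ℤ
shift-below (suc k) g zero    _         = refl
shift-below (suc k) g (suc n) (s≤s n<k) = shift-below k g n n<k

shift-above : ∀ k g n → k ≤ n → shift k g n ≡ g (n ℕ.∸ k)
shift-above zero    g n       _         = refl
shift-above (suc k) g (suc n) (s≤s k≤n) = shift-above k g n k≤n

mono-below : ∀ k n → n < k → (q^ k) n ≡ 0ℤ
mono-below (suc k) zero    _         = refl
mono-below (suc k) (suc n) (s≤s n<k) = mono-below k n n<k

mono-self : ∀ k → (q^ k) k ≡ 1ℤ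
mono-self zero    = refl
mono-self (suc k) = mono-self k

mono-other : ∀ k n → k ≢ n → (q^ k) n ≡ 0ℤ
mono-other zero    zero    k≢n = ⊥-elim (k≢n refl)
mono-other zero    (suc n) _   = refl
mono-other (suc k) zero    _   = refl
mono-other (suc k) (suc n) k≢n = mono-other k n (k≢n ∘ cong suc)

euler-factor-coeff : ∀ k n → eulerFactor (suc k) n ≡ (κ 1ℤ -ₛ q^ suc k) n
euler-factor-coeff k zero = refl
euler-factor-coeff k (suc j) with suc k ℕ.≟ suc j
... | yes refl = cong (λ x → 0ℤ - x) (sym (mono-self k))
... | no k≢j   = cong (λ x → 0ℤ - x) (sym (mono-other k j (k≢j ∘ cong suc)))

geometric-periodic : ∀ k n → k ≤ n → geomFactor k n ≡ geomFactor k (n ℕ.∸ k)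
geometric-periodic k n k≤n with k ∣? n | k ∣? (n ℕ.∸ k)
... | yes _   | yes _   = refl
... | no _    | no _    = refl
... | yes k∣n | no k∤n-k =
  ⊥-elim (k∤n-k (ℕD.∣m+n∣m⇒∣n (subst (k ℕD.∣_) (sym (ℕP.m+[n∸m]≡n k≤n)) k∣n) ℕD.∣-refl))
... | no k∤n  | yes k∣n-k = ⊥-elim (k∤n (ℕD.∣m∸n∣n⇒∣m k k≤n k∣n-k ℕD.∣-refl))

geometric-below : ∀ k n → n < k → geomFactor k n ≡ one n
geometric-below k zero _ with k ∣? 0
... | yes _   = refl
... | no k∤0  = ⊥-elim (k∤0 (k ℕD.∣0))
geometric-below k (suc n) n<k with k ∣? suc n
... | yes k∣n = ⊥-elim (ℕP.<⇒≱ n<k (ℕD.∣⇒≤ k∣n))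
... | no _    = refl

-- The defining property of the geometric series: (1 - q^k) · Σ_j q^(kj) = 1,
-- in the form  g - q^k g = 1  for g = 1/(1 - q^k).
geometric-coeff : ∀ k n → (geomFactor (suc k) -ₛ shift (suc k) (geomFactor (suc k))) n ≡ one n
geometric-coeff k n with suc k ℕ.≤? n
... | yes k<n = begin
  g n - shift (suc k) g n     ≡⟨ cong (_-_ (g n)) (shift-above (suc k) g n k<n) ⟩
  g n - g (n ℕ.∸ suc k)       ≡⟨ cong (_- g (n ℕ.∸ suc k)) (geometric-periodic (suc k) n k<n) ⟩
  g (n ℕ.∸ suc k) - g (n ℕ.∸ suc k) ≡⟨ ℤP.+-inverseʳ (g (n ℕ.∸ suc k)) ⟩
  0ℤ                          ≡⟨ sym (one-above k<n) ⟩
  one n                       ∎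
  where
  open P.≡-Reasoning
  g : Series
  g = geomFactor (suc k)
  one-above : ∀ {n} → suc k ≤ n → one n ≡ 0ℤ
  one-above {suc n} _ = refl
... | no k≮n = trans (cong (_-_ (geomFactor (suc k) n)) (shift-below (suc k) _ n (ℕP.≰⇒> k≮n)))
                     (trans (ℤP.+-identityʳ _) (geometric-below (suc k) n (ℕP.≰⇒> k≮n)))

E G : ℕ → Series
E = eulerTrunc
G = partTrunc

-- The finite identity sums over
-- k = a - r for r = 0, …, a + b + 1; the terms carry the triangular exponent
-- k(k+1)/2, the sign (-1)^k and the weight (2k+1)(-1)^k.

-- diff a r = a - r, by a recursion that matches the summation index r.
diff : ℕ → ℕ → ℤ
diff a       zero    = + a
diff zero    (suc r) = -[1+ r ]
diff (suc a) (suc r) = diff a r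

triangle : ℕ → ℕ
triangle zero    = 0
triangle (suc n) = suc n ℕ.+ triangle n

-- tri k = k(k+1)/2, which is invariant under k ↦ -k-1.
tri : ℤ → ℕ
tri (+ n)    = triangle n
tri -[1+ n ] = triangle n

altN : ℕ → ℤ
altN zero    = 1ℤ
altN (suc n) = - altN n

sgn : ℤ → ℤ
sgn (+ n)    = altN n
sgn -[1+ n ] = altN (suc n)

weight : ℤ → ℤ
weight k = (+ 2 * k + 1ℤ) * sgn k

diff-suc : ∀ a r → diff (suc a) r ≡ diff a r + 1ℤ
diff-suc a       zero          = cong +_ (ℕP.+-comm 1 a)
diff-suc zero    (suc zero)    = refl
diff-suc zero    (suc (suc r)) = refl
diff-suc (suc a) (suc r)       = diff-suc a r

diff-is-sub : ∀ a r → diff a r ≡ + a - + r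
diff-is-sub a       zero    = sym (ℤP.+-identityʳ (+ a))
diff-is-sub zero    (suc r) = refl
diff-is-sub (suc a) (suc r) = trans (diff-is-sub a r)
  (trans (ℤP.m-n≡m⊖n a r) (trans (sym (ℤP.[1+m]⊖[1+n]≡m⊖n a r)) (sym (ℤP.m-n≡m⊖n (suc a) (suc r)))))

-- If r + s = a + b + 1 then a - s = -(b - r) - 1: reading the sum backwards
-- reflects the index k ↦ -k-1.
diff-reflect : ∀ a b r s → r ℕ.+ s ≡ suc (a ℕ.+ b) → diff a s ≡ - diff b r - 1ℤ
diff-reflect a b r s r+s≡n = begin
  diff a s                                     ≡⟨ diff-is-sub a s ⟩
  + a - + s                                    ≡⟨ lemma (+ a) (+ b) (+ r) (+ s) ⟩
  ((+ a + + b + 1ℤ) - (+ r + + s)) + (- (+ b - + r) - 1ℤ)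
    ≡⟨ cong (_+ (- (+ b - + r) - 1ℤ)) difference-zero ⟩
  0ℤ + (- (+ b - + r) - 1ℤ)                    ≡⟨ ℤP.+-identityˡ _ ⟩
  - (+ b - + r) - 1ℤ                           ≡⟨ cong (λ z → - z - 1ℤ) (sym (diff-is-sub b r)) ⟩
  - diff b r - 1ℤ                              ∎
  where
  open P.≡-Reasoning
  lemma : ∀ a b r s → a - s ≡ ((a + b + 1ℤ) - (r + s)) + (- (b - r) - 1ℤ)
  lemma = solve-∀
  difference-zero : (+ a + + b + 1ℤ) - (+ r + + s) ≡ 0ℤ
  difference-zero = trans (cong₂ (λ x y → + x - + y) (ℕP.+-comm (a ℕ.+ b) 1) r+s≡n)
                          (ℤP.+-inverseʳ (+ suc (a ℕ.+ b)))

tri-diff-step : ∀ a r → r ℕ.+ tri (diff (suc a) r) ≡ suc a ℕ.+ tri (diff a r)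
tri-diff-step a       zero    = refl
tri-diff-step zero    (suc r) = trans (ℕP.+-comm (suc r) (tri (diff 0 r)))
                                      (trans (ℕP.+-suc (tri (diff 0 r)) r) (cong suc (tri-0 r)))
  where
  tri-0 : ∀ r → tri (diff 0 r) ℕ.+ r ≡ triangle r
  tri-0 zero    = refl
  tri-0 (suc r) = ℕP.+-comm (triangle r) (suc r)
tri-diff-step (suc a) (suc r) = cong suc (tri-diff-step a r)

negsuc-is-sub : ∀ n → -[1+ n ] ≡ - (+ n) - 1ℤ
negsuc-is-sub zero    = refl
negsuc-is-sub (suc n) = cong (λ z → -[1+ suc z ]) (sym (ℕP.+-identityʳ n))

sgn-suc : ∀ k → sgn (k + 1ℤ) ≡ - sgn k
sgn-suc (+ n)            = cong altN (ℕP.+-comm n 1)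
sgn-suc -[1+ zero ]      = sym (ℤP.neg-involutive 1ℤ)
sgn-suc -[1+ suc n ]     = sym (ℤP.neg-involutive (altN (suc n)))

weight-suc : ∀ k → weight (k + 1ℤ) ≡ - (weight k + + 2 * sgn k)
weight-suc k = trans (cong ((+ 2 * (k + 1ℤ) + 1ℤ) *_) (sgn-suc k)) (lemma k (sgn k))
  where lemma : ∀ k s → (+ 2 * (k + 1ℤ) + 1ℤ) * (- s) ≡ - ((+ 2 * k + 1ℤ) * s + + 2 * s)
        lemma = solve-∀

tri-reflect : ∀ k → tri (- k - 1ℤ) ≡ tri k
tri-reflect (+ n)    = cong tri (sym (negsuc-is-sub n))
tri-reflect -[1+ n ] = refl

sgn-reflect : ∀ k → sgn (- k - 1ℤ) ≡ - 1ℤ * sgn k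
sgn-reflect (+ n)    = trans (cong sgn (sym (negsuc-is-sub n))) (sym (ℤP.-1*i≡-i (altN n)))
sgn-reflect -[1+ n ] = trans (sym (ℤP.neg-involutive (altN n))) (sym (ℤP.-1*i≡-i (altN (suc n))))

weight-reflect : ∀ k → weight (- k - 1ℤ) ≡ 1ℤ * weight k
weight-reflect k = trans (cong ((+ 2 * (- k - 1ℤ) + 1ℤ) *_) (sgn-reflect k)) (lemma k (sgn k))
  where lemma : ∀ k s → (+ 2 * (- k - 1ℤ) + 1ℤ) * (- 1ℤ * s) ≡ 1ℤ * ((+ 2 * k + 1ℤ) * s)
        lemma = solve-∀

diff-below : ∀ a r → r ≤ a → diff a r ≡ + (a ℕ.∸ r)
diff-below a       zero    _         = refl
diff-below (suc a) (suc r) (s≤s r≤a) = diff-below a r r≤a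

triangle-≥ : ∀ n → n ≤ triangle n
triangle-≥ zero    = z≤n
triangle-≥ (suc n) = ℕP.m≤m+n (suc n) (triangle n)

far-exponent : ∀ M r → r < M → M < tri (diff (M ℕ.+ M) r)
far-exponent M r r<M = begin-strict
  M                          <⟨ ℕP.m<m+n M (ℕP.m<n⇒0<n∸m r<M) ⟩
  M ℕ.+ (M ℕ.∸ r)            ≡⟨ sym (ℕP.+-∸-assoc M (ℕP.<⇒≤ r<M)) ⟩
  (M ℕ.+ M) ℕ.∸ r            ≤⟨ triangle-≥ _ ⟩
  triangle ((M ℕ.+ M) ℕ.∸ r) ≡⟨ cong tri (sym (diff-below (M ℕ.+ M) r (ℕP.≤-trans (ℕP.<⇒≤ r<M) (ℕP.m≤m+n M M)))) ⟩
  tri (diff (M ℕ.+ M) r)     ∎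
  where open ℕP.≤-Reasoning

conv-cong-mod : ∀ {d a a′ b b′} n → (∀ i → i ≤ n → a i ≡ a′ i [mod d ]) →
                (∀ i → i ≤ n → b i ≡ b′ i [mod d ]) → (a ⊛ b) n ≡ (a′ ⊛ b′) n [mod d ]
conv-cong-mod zero ea eb = mod-+ (mod-* (ea 0 z≤n) (eb 0 z≤n)) mod-refl
conv-cong-mod {d} {a} {a′} {b} {b′} (suc n) ea eb =
  mod-trans (≡⇒≡mod (conv-suc a b n))
    (mod-trans (mod-+ (mod-* (ea 0 z≤n) (eb (suc n) ℕP.≤-refl))
                      (conv-cong-mod n (λ i i≤n → ea (suc i) (s≤s i≤n))
                                       (λ i i≤n → eb i (ℕP.m≤n⇒m≤1+n i≤n))))
               (≡⇒≡mod (sym (conv-suc a′ b′ n))))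

-- Series modulo (d, q^(M+1)): two series are identified when their
-- coefficients of index ≤ M agree modulo d.  This quotient is a commutative
-- ring, in which all power series identities below are proved; with d = 0
-- it is the ring of series truncated at degree M.

module Truncated (d : ℤ) (M : ℕ) where

  infix 4 _≈_
  record _≈_ (a b : Series) : Set where
    constructor mk≈
    field coeff : ∀ i → i ≤ M → a i ≡ b i [mod d ]
  open _≈_ public

  pointwise : ∀ {a b} → (∀ i → a i ≡ b i) → a ≈ b
  pointwise e = mk≈ λ i _ → ≡⇒≡mod (e i)

  private
    ≈-isEquivalence : IsEquivalence _≈_
    ≈-isEquivalence = record
      { refl  = mk≈ λ i _ → mod-refl
      ; sym   = λ e → mk≈ λ i p → mod-sym (coeff e i p)
      ; trans = λ e f → mk≈ λ i p → mod-trans (coeff e i p) (coeff f i p)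
      }

    ⊛-comm : ∀ a b → a ⊛ b ≈ b ⊛ a
    ⊛-comm a b = pointwise (conv-comm a b)

  +ₛ-cong : ∀ {a b c e} → a ≈ b → c ≈ e → a +ₛ c ≈ b +ₛ e
  +ₛ-cong x y = mk≈ λ i p → mod-+ (coeff x i p) (coeff y i p)

  ⊛-cong : ∀ {a b c e} → a ≈ b → c ≈ e → a ⊛ c ≈ b ⊛ e
  ⊛-cong x y = mk≈ λ n p → conv-cong-mod n (λ i q → coeff x i (ℕP.≤-trans q p))
                                           (λ i q → coeff y i (ℕP.≤-trans q p))

  isCommutativeRing : IsCommutativeRing _≈_ _+ₛ_ _⊛_ -ₛ_ 0ₛ one
  isCommutativeRing = record
    { isRing = record
      { +-isAbelianGroup = record
        { isGroup = record
          { isMonoid = record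
            { isSemigroup = record
              { isMagma = record { isEquivalence = ≈-isEquivalence ; ∙-cong = +ₛ-cong }
              ; assoc   = λ a b c → pointwise λ i → ℤP.+-assoc (a i) (b i) (c i) }
            ; identity = (λ a → pointwise λ i → ℤP.+-identityˡ (a i))
                       , (λ a → pointwise λ i → ℤP.+-identityʳ (a i)) }
          ; inverse = (λ a → pointwise λ i → ℤP.+-inverseˡ (a i))
                    , (λ a → pointwise λ i → ℤP.+-inverseʳ (a i))
          ; ⁻¹-cong = λ e → mk≈ λ i p → mod-neg (coeff e i p) }
        ; comm = λ a b → pointwise λ i → ℤP.+-comm (a i) (b i) }
      ; *-cong     = ⊛-cong
      ; *-assoc    = λ a b c → pointwise (conv-assoc a b c)
      ; *-identity = comm∧idˡ⇒id ≈-setoid ⊛-comm (λ a → pointwise (conv-oneˡ a))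
      ; distrib    = comm∧distrʳ⇒distr ≈-setoid +ₛ-cong ⊛-comm
                       (λ a b c → pointwise (conv-distribʳ b c a)) }
    ; *-comm = ⊛-comm }
    where
    ≈-setoid : Setoid 0ℓ 0ℓ
    ≈-setoid = record { isEquivalence = ≈-isEquivalence }

  commutativeRing : CommutativeRing 0ℓ 0ℓ
  commutativeRing = record { isCommutativeRing = isCommutativeRing }

  open CommutativeRing commutativeRing public
    using ( setoid; reflexive; -‿cong
          ; *-identityˡ; *-identityʳ; *-comm; *-assoc; +-identityʳ
          ; distribˡ; zeroˡ; zeroʳ; +-comm; +-assoc; -‿inverseʳ)
    renaming (sym to ≈-sym; trans to ≈-trans; refl to ≈-refl)
  open import Relation.Binary.Reasoning.Setoid setoid public

  ⊛-congˡ : ∀ a {b c} → b ≈ c → a ⊛ b ≈ a ⊛ c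
  ⊛-congˡ a = ⊛-cong (≈-refl {a})

  ⊛-congʳ : ∀ c {a b} → a ≈ b → a ⊛ c ≈ b ⊛ c
  ⊛-congʳ c a≈b = ⊛-cong a≈b (≈-refl {c})

  +ₛ-congˡ : ∀ a {b c} → b ≈ c → a +ₛ b ≈ a +ₛ c
  +ₛ-congˡ a = +ₛ-cong (≈-refl {a})

  +ₛ-congʳ : ∀ c {a b} → a ≈ b → a +ₛ c ≈ b +ₛ c
  +ₛ-congʳ c a≈b = +ₛ-cong a≈b (≈-refl {c})

  -- ℤ embeds into the ring through κ, so the ring solver can use integer constants.
  κ-homomorphism : ℤ.+-*-rawRing -Raw-AlmostCommutative⟶ fromCommutativeRing commutativeRing
  κ-homomorphism = record
    { ⟦_⟧    = κ
    ; +-homo = λ c e → pointwise λ { zero → refl ; (suc n) → refl }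
    ; *-homo = λ c e → pointwise λ { zero → sym (κ-conv c (κ e) 0)
                                   ; (suc n) → sym (trans (κ-conv c (κ e) (suc n)) (ℤP.*-zeroʳ c)) }
    ; -‿homo = λ c → pointwise λ { zero → refl ; (suc n) → refl }
    ; 0-homo = pointwise λ { zero → refl ; (suc n) → refl }
    ; 1-homo = pointwise λ { zero → refl ; (suc n) → refl } }

  open _-Raw-AlmostCommutative⟶_ κ-homomorphism public
    using () renaming (+-homo to κ-+; *-homo to κ-*; -‿homo to κ-neg; 0-homo to κ-zero; 1-homo to κ-one)

  private
    κ-≟ : ∀ c e → Maybe (κ c ≈ κ e)
    κ-≟ c e with c ℤ.≟ e
    ... | yes refl = just ≈-refl
    ... | no _     = nothing

  open Algebra.Solver.Ring ℤ.+-*-rawRing (fromCommutativeRing commutativeRing) κ-homomorphism κ-≟ public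
    using (solve; _:+_; _:*_; _:-_; :-_; _:^_; con; _:=_)

  mono-+ : ∀ i j → q^ i ⊛ q^ j ≈ q^ (i ℕ.+ j)
  mono-+ i j = pointwise λ n → trans (mono-conv i (q^ j) n) (shift-mono i j n)

  mono-power : ∀ k m → (q^ k) ^ₛ m ≈ q^ (m ℕ.* k)
  mono-power k zero    = ≈-refl
  mono-power k (suc m) = ≈-trans (⊛-congˡ (q^ k) (mono-power k m)) (mono-+ k (m ℕ.* k))

  euler-factor : ∀ k → eulerFactor (suc k) ≈ κ 1ℤ -ₛ q^ suc k
  euler-factor k = pointwise (euler-factor-coeff k)

  geometric-inverse : ∀ k → geomFactor (suc k) ⊛ eulerFactor (suc k) ≈ one
  geometric-inverse k = begin
    g ⊛ eulerFactor (suc k)  ≈⟨ ⊛-congˡ g (euler-factor k) ⟩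
    g ⊛ (κ 1ℤ -ₛ q^ suc k)   ≈⟨ solve 2 (λ g x → g :* (con 1ℤ :- x) := g :- x :* g) ≈-refl g (q^ suc k) ⟩
    g -ₛ q^ suc k ⊛ g        ≈⟨ pointwise (λ n → trans (cong (_-_ (g n)) (mono-conv (suc k) g n)) (geometric-coeff k n)) ⟩
    one                      ∎
    where g : Series
          g = geomFactor (suc k)

  -- Powers: the power ^ₛ of Defs is the monoid power of the ring, so the
  -- library's exponent laws apply.

  private
    module Exp = Algebra.Properties.CommutativeSemiring.Exp (CommutativeRing.commutativeSemiring commutativeRing)

    ^ₛ-is-^ : ∀ a n → a ^ₛ n ≡ a Exp.^ n
    ^ₛ-is-^ a zero    = refl
    ^ₛ-is-^ a (suc n) = cong (a ⊛_) (^ₛ-is-^ a n)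

  pow-cong : ∀ {a b} m → a ≈ b → a ^ₛ m ≈ b ^ₛ m
  pow-cong {a} {b} m a≈b = begin
    a ^ₛ m     ≡⟨ ^ₛ-is-^ a m ⟩
    a Exp.^ m  ≈⟨ Exp.^-congˡ m a≈b ⟩
    b Exp.^ m  ≡⟨ sym (^ₛ-is-^ b m) ⟩
    b ^ₛ m     ∎

  pow-+ : ∀ a m n → a ^ₛ (m ℕ.+ n) ≈ a ^ₛ m ⊛ a ^ₛ n
  pow-+ a m n = begin
    a ^ₛ (m ℕ.+ n)            ≡⟨ ^ₛ-is-^ a (m ℕ.+ n) ⟩
    a Exp.^ (m ℕ.+ n)         ≈⟨ Exp.^-homo-* a m n ⟩
    a Exp.^ m ⊛ a Exp.^ n     ≡⟨ sym (cong₂ _⊛_ (^ₛ-is-^ a m) (^ₛ-is-^ a n)) ⟩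
    a ^ₛ m ⊛ a ^ₛ n           ∎

  pow-* : ∀ a m n → a ^ₛ (m ℕ.* n) ≈ (a ^ₛ m) ^ₛ n
  pow-* a m n = begin
    a ^ₛ (m ℕ.* n)            ≡⟨ ^ₛ-is-^ a (m ℕ.* n) ⟩
    a Exp.^ (m ℕ.* n)         ≈⟨ ≈-sym (Exp.^-assocʳ a m n) ⟩
    (a Exp.^ m) Exp.^ n       ≡⟨ sym (trans (^ₛ-is-^ (a ^ₛ m) n) (cong (Exp._^ n) (^ₛ-is-^ a m))) ⟩
    (a ^ₛ m) ^ₛ n             ∎

  pow-⊛ : ∀ a b m → (a ⊛ b) ^ₛ m ≈ a ^ₛ m ⊛ b ^ₛ m
  pow-⊛ a b m = begin
    (a ⊛ b) ^ₛ m              ≡⟨ ^ₛ-is-^ (a ⊛ b) m ⟩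
    (a ⊛ b) Exp.^ m           ≈⟨ Exp.^-distrib-* a b m ⟩
    a Exp.^ m ⊛ b Exp.^ m     ≡⟨ sym (cong₂ _⊛_ (^ₛ-is-^ a m) (^ₛ-is-^ b m)) ⟩
    a ^ₛ m ⊛ b ^ₛ m           ∎

  one-power : ∀ m → one ^ₛ m ≈ one
  one-power zero    = ≈-refl
  one-power (suc m) = ≈-trans (⊛-congˡ one (one-power m)) (*-identityˡ one)

  pow-multiple : ∀ a {s} m → a ^ₛ m ≈ s → ∀ μ → a ^ₛ (m ℕ.* μ) ≈ s ^ₛ μ
  pow-multiple a m aᵐ≈s μ = ≈-trans (pow-* a m μ) (pow-cong μ aᵐ≈s)

  pow-inverse : ∀ a b m → a ⊛ b ≈ one → a ^ₛ m ⊛ b ^ₛ m ≈ one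
  pow-inverse a b zero    ab≈1 = *-identityˡ one
  pow-inverse a b (suc m) ab≈1 = begin
    (a ⊛ a ^ₛ m) ⊛ (b ⊛ b ^ₛ m)   ≈⟨ solve 4 (λ a b x y → (a :* x) :* (b :* y) := (a :* b) :* (x :* y)) ≈-refl a b (a ^ₛ m) (b ^ₛ m) ⟩
    (a ⊛ b) ⊛ (a ^ₛ m ⊛ b ^ₛ m)   ≈⟨ ⊛-cong ab≈1 (pow-inverse a b m ab≈1) ⟩
    one ⊛ one                     ≈⟨ *-identityˡ one ⟩
    one                           ∎

  product-inverse : ∀ f h → (∀ k → f (suc k) ⊛ h (suc k) ≈ one) →
                    ∀ n → prodUpTo f n ⊛ prodUpTo h n ≈ one
  product-inverse f h fh≈1 zero    = *-identityˡ one
  product-inverse f h fh≈1 (suc n) = begin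
    (F ⊛ f (suc n)) ⊛ (H ⊛ h (suc n))   ≈⟨ solve 4 (λ a b x y → (a :* x) :* (b :* y) := (a :* b) :* (x :* y)) ≈-refl F H (f (suc n)) (h (suc n)) ⟩
    (F ⊛ H) ⊛ (f (suc n) ⊛ h (suc n))   ≈⟨ ⊛-cong (product-inverse f h fh≈1 n) (fh≈1 n) ⟩
    one ⊛ one                           ≈⟨ *-identityˡ one ⟩
    one                                 ∎
    where F H : Series
          F = prodUpTo f n
          H = prodUpTo h n

  G⊛E : ∀ n → G n ⊛ E n ≈ one
  G⊛E = product-inverse geomFactor eulerFactor geometric-inverse

  -- Inverses are unique; used to identify 1/(q;q)^5 with 1/(q^5;q^5).
  inverse-unique : ∀ {a a′ b} → a ⊛ b ≈ one → a′ ⊛ b ≈ one → a ≈ a′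
  inverse-unique {a} {a′} {b} ab≈1 a′b≈1 = begin
    a                ≈⟨ ≈-sym (*-identityʳ a) ⟩
    a ⊛ one          ≈⟨ ⊛-congˡ a (≈-sym (≈-trans (*-comm b a′) a′b≈1)) ⟩
    a ⊛ (b ⊛ a′)     ≈⟨ ≈-sym (*-assoc a b a′) ⟩
    (a ⊛ b) ⊛ a′     ≈⟨ ⊛-congʳ a′ ab≈1 ⟩
    one ⊛ a′         ≈⟨ *-identityˡ a′ ⟩
    a′               ∎

  insert-inverse : ∀ a k → a ≈ a ⊛ (geomFactor (suc k) ⊛ eulerFactor (suc k))
  insert-inverse a k = ≈-trans (≈-sym (*-identityʳ a)) (⊛-congˡ a (≈-sym (geometric-inverse k)))

  -- The Gaussian binomial coefficient [r+s choose r]_q = (q;q)_{r+s} / ((q;q)_r (q;q)_s).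

  gauss : ℕ → ℕ → Series
  gauss r s = (G r ⊛ G s) ⊛ E (r ℕ.+ s)

  gauss-r0 : ∀ r → gauss r 0 ≈ one
  gauss-r0 r = begin
    (G r ⊛ one) ⊛ E (r ℕ.+ 0) ≈⟨ ⊛-cong (*-identityʳ (G r)) (reflexive (cong E (ℕP.+-identityʳ r))) ⟩
    G r ⊛ E r                 ≈⟨ G⊛E r ⟩
    one                       ∎

  gauss-0s : ∀ s → gauss 0 s ≈ one
  gauss-0s s = ≈-trans (⊛-congʳ (E s) (*-identityˡ (G s))) (G⊛E s)

  gauss-sym : ∀ r s → gauss r s ≈ gauss s r
  gauss-sym r s = ⊛-cong (*-comm (G r) (G s)) (reflexive (cong E (ℕP.+-comm r s)))

  -- The q-Pascal rule [r+s+2 choose r+1] = [r+s+1 choose r] + q^(r+1) [r+s+1 choose r+1],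
  -- verified by clearing the denominators (1 - q^(r+1)) and (1 - q^(s+1)).
  gauss-pascal : ∀ r s → gauss (suc r) (suc s) ≈ gauss r (suc s) +ₛ q^ suc r ⊛ gauss (suc r) s
  gauss-pascal r s = ≈-sym (begin
    gauss r (suc s) +ₛ x ⊛ gauss (suc r) s
      ≈⟨ +ₛ-congʳ (x ⊛ gauss (suc r) s) (⊛-congˡ (X ⊛ (Y ⊛ gy)) (reflexive (cong E (ℕP.+-suc r s)))) ⟩
    (X ⊛ (Y ⊛ gy)) ⊛ Z +ₛ x ⊛ (((X ⊛ gx) ⊛ Y) ⊛ Z)
      ≈⟨ +ₛ-cong (insert-inverse ((X ⊛ (Y ⊛ gy)) ⊛ Z) r)
                 (insert-inverse (x ⊛ (((X ⊛ gx) ⊛ Y) ⊛ Z)) s) ⟩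
    ((X ⊛ (Y ⊛ gy)) ⊛ Z) ⊛ (gx ⊛ eulerFactor (suc r)) +ₛ (x ⊛ (((X ⊛ gx) ⊛ Y) ⊛ Z)) ⊛ (gy ⊛ eulerFactor (suc s))
      ≈⟨ +ₛ-cong (⊛-congˡ ((X ⊛ (Y ⊛ gy)) ⊛ Z) (⊛-congˡ gx (euler-factor r)))
                 (⊛-congˡ (x ⊛ (((X ⊛ gx) ⊛ Y) ⊛ Z)) (⊛-congˡ gy (euler-factor s))) ⟩
    ((X ⊛ (Y ⊛ gy)) ⊛ Z) ⊛ (gx ⊛ (κ 1ℤ -ₛ x)) +ₛ (x ⊛ (((X ⊛ gx) ⊛ Y) ⊛ Z)) ⊛ (gy ⊛ (κ 1ℤ -ₛ y))
      ≈⟨ solve 7 (λ X Y Z gx gy x y →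
                    ((X :* (Y :* gy)) :* Z) :* (gx :* (con 1ℤ :- x)) :+ (x :* (((X :* gx) :* Y) :* Z)) :* (gy :* (con 1ℤ :- y))
                    := ((X :* gx) :* (Y :* gy)) :* (Z :* (con 1ℤ :- x :* y)))
               ≈-refl X Y Z gx gy x y ⟩
    ((X ⊛ gx) ⊛ (Y ⊛ gy)) ⊛ (Z ⊛ (κ 1ℤ -ₛ x ⊛ y))
      ≈⟨ ⊛-congˡ ((X ⊛ gx) ⊛ (Y ⊛ gy)) (⊛-congˡ Z (+ₛ-congˡ (κ 1ℤ) (-‿cong (mono-+ (suc r) (suc s))))) ⟩
    ((X ⊛ gx) ⊛ (Y ⊛ gy)) ⊛ (Z ⊛ (κ 1ℤ -ₛ q^ (suc r ℕ.+ suc s)))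
      ≈⟨ ⊛-congˡ ((X ⊛ gx) ⊛ (Y ⊛ gy)) (⊛-cong (reflexive (cong E (sym (ℕP.+-suc r s)))) (≈-sym (euler-factor (r ℕ.+ suc s)))) ⟩
    gauss (suc r) (suc s) ∎)
    where
    X Y Z gx gy x y : Series
    X = G r
    Y = G s
    Z = E (suc (r ℕ.+ s))
    gx = geomFactor (suc r)
    gy = geomFactor (suc s)
    x = q^ suc r
    y = q^ suc s

  sum : (ℕ → Series) → ℕ → Series
  sum f zero    = 0ₛ
  sum f (suc n) = f 0 +ₛ sum (f ∘ suc) n

  sum-cong : ∀ n {f g} → (∀ i → i < n → f i ≈ g i) → sum f n ≈ sum g n
  sum-cong zero    f≈g = ≈-refl
  sum-cong (suc n) f≈g = +ₛ-cong (f≈g 0 (s≤s z≤n)) (sum-cong n (λ i i<n → f≈g (suc i) (s≤s i<n)))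

  sum-+ : ∀ n f g → sum (λ i → f i +ₛ g i) n ≈ sum f n +ₛ sum g n
  sum-+ zero    f g = ≈-sym (+-identityʳ 0ₛ)
  sum-+ (suc n) f g = ≈-trans (+ₛ-congˡ (f 0 +ₛ g 0) (sum-+ n (f ∘ suc) (g ∘ suc)))
    (solve 4 (λ a b c e → (a :+ b) :+ (c :+ e) := (a :+ c) :+ (b :+ e)) ≈-refl
       (f 0) (g 0) (sum (f ∘ suc) n) (sum (g ∘ suc) n))

  sum-scale : ∀ n c f → sum (λ i → c ⊛ f i) n ≈ c ⊛ sum f n
  sum-scale zero    c f = ≈-sym (zeroʳ c)
  sum-scale (suc n) c f = ≈-trans (+ₛ-congˡ (c ⊛ f 0) (sum-scale n c (f ∘ suc)))
                                  (≈-sym (distribˡ c (f 0) (sum (f ∘ suc) n)))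

  sum-last : ∀ n f → sum f (suc n) ≈ sum f n +ₛ f n
  sum-last zero    f = +-comm (f 0) 0ₛ
  sum-last (suc n) f = ≈-trans (+ₛ-congˡ (f 0) (sum-last n (f ∘ suc)))
                               (≈-sym (+-assoc (f 0) (sum (f ∘ suc) n) (f (suc n))))

  sum-reverse : ∀ n f → sum f n ≈ sum (λ i → f (n ℕ.∸ suc i)) n
  sum-reverse zero    f = ≈-refl
  sum-reverse (suc n) f = begin
    f 0 +ₛ sum (f ∘ suc) n                         ≈⟨ +ₛ-congˡ (f 0) (sum-reverse n (f ∘ suc)) ⟩
    f 0 +ₛ sum (λ i → f (suc (n ℕ.∸ suc i))) n     ≈⟨ +-comm (f 0) _ ⟩
    sum (λ i → f (suc (n ℕ.∸ suc i))) n +ₛ f 0     ≈⟨ +ₛ-cong (sum-cong n (λ i i<n → reflexive (cong f (sym (ℕP.+-∸-assoc 1 i<n)))))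
                                                              (reflexive (cong f (sym (ℕP.n∸n≡0 n)))) ⟩
    sum (λ i → f (n ℕ.∸ i)) n +ₛ f (n ℕ.∸ n)       ≈⟨ ≈-sym (sum-last n (λ i → f (n ℕ.∸ i))) ⟩
    sum (λ i → f (n ℕ.∸ i)) (suc n)                ∎

  antidiagonal : (ℕ → ℕ → Series) → ℕ → Series
  antidiagonal h n = sum (λ r → h r (n ℕ.∸ r)) (suc n)

  antidiagonal-cong : ∀ n h h′ → (∀ r → r ≤ n → h r (n ℕ.∸ r) ≈ h′ r (n ℕ.∸ r)) →
                      antidiagonal h n ≈ antidiagonal h′ n
  antidiagonal-cong n h h′ h≈h′ = sum-cong (suc n) (λ r r<n → h≈h′ r (ℕP.≤-pred r<n))

  antidiagonal-+ : ∀ n h h′ → antidiagonal (λ r s → h r s +ₛ h′ r s) n ≈ antidiagonal h n +ₛ antidiagonal h′ n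
  antidiagonal-+ n h h′ = sum-+ (suc n) (λ r → h r (n ℕ.∸ r)) (λ r → h′ r (n ℕ.∸ r))

  antidiagonal-scale : ∀ n c h → antidiagonal (λ r s → c ⊛ h r s) n ≈ c ⊛ antidiagonal h n
  antidiagonal-scale n c h = sum-scale (suc n) c (λ r → h r (n ℕ.∸ r))

  antidiagonal-last : ∀ n h → antidiagonal h (suc n) ≈ antidiagonal (λ r s → h r (suc s)) n +ₛ h (suc n) 0
  antidiagonal-last n h = begin
    antidiagonal h (suc n)
      ≈⟨ sum-last (suc n) (λ r → h r (suc n ℕ.∸ r)) ⟩
    sum (λ r → h r (suc n ℕ.∸ r)) (suc n) +ₛ h (suc n) (n ℕ.∸ n)
      ≈⟨ +ₛ-cong (sum-cong (suc n) (λ r r<n → reflexive (cong (h r) (ℕP.+-∸-assoc 1 (ℕP.≤-pred r<n)))))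
                 (reflexive (cong (h (suc n)) (ℕP.n∸n≡0 n))) ⟩
    antidiagonal (λ r s → h r (suc s)) n +ₛ h (suc n) 0 ∎

  antidiagonal-swap : ∀ n h → antidiagonal h n ≈ antidiagonal (λ r s → h s r) n
  antidiagonal-swap n h = ≈-trans (sum-reverse (suc n) (λ r → h r (n ℕ.∸ r)))
    (sum-cong (suc n) (λ i i<n → reflexive (cong (h (n ℕ.∸ i)) (ℕP.m∸[m∸n]≡n (ℕP.≤-pred i<n)))))

  -- Jacobi sums.  For u : ℤ → Series put
  --   jacobiSum u a b = Σ_{r+s=a+b+1} u(a-r) [r+s choose r]_q,
  -- applied to the terms triMono c k = c(k) q^(k(k+1)/2).

  triMono : (ℤ → ℤ) → ℤ → Series
  triMono c k = κ (c k) ⊛ q^ tri k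

  jacobiSum : (ℤ → Series) → ℕ → ℕ → Series
  jacobiSum u a b = antidiagonal (λ r s → u (diff a r) ⊛ gauss r s) (suc (a ℕ.+ b))

  -- Raising a by one: by the q-Pascal rule the sum for a+1 is the sum for a
  -- plus the sum of the terms q^r u(a+1-r) [r+s choose r].
  jacobiSum-suc : ∀ u a b → jacobiSum u (suc a) b ≈
    jacobiSum u a b +ₛ antidiagonal (λ r s → (q^ r ⊛ u (diff (suc a) r)) ⊛ gauss r s) (suc (a ℕ.+ b))
  jacobiSum-suc u a b = begin
    u (+ suc a) ⊛ gauss 0 (suc (suc m)) +ₛ antidiagonal (λ r s → u (diff a r) ⊛ gauss (suc r) s) (suc m)
      ≈⟨ +ₛ-congˡ (u (+ suc a) ⊛ gauss 0 (suc (suc m))) (antidiagonal-last m (λ r s → u (diff a r) ⊛ gauss (suc r) s)) ⟩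
    u (+ suc a) ⊛ gauss 0 (suc (suc m)) +ₛ (antidiagonal (λ r s → u (diff a r) ⊛ gauss (suc r) (suc s)) m +ₛ u (diff a (suc m)) ⊛ gauss (suc (suc m)) 0)
      ≈⟨ +ₛ-cong (⊛-congˡ (u (+ suc a)) (≈-trans (gauss-0s (suc (suc m))) (≈-sym (gauss-0s (suc m)))))
                 (+ₛ-cong (antidiagonal-cong m (λ r s → u (diff a r) ⊛ gauss (suc r) (suc s)) (λ r s → H r (suc s) +ₛ Q r s)
                                             (λ r _ → pascal r (m ℕ.∸ r)))
                          (⊛-congˡ (u (diff a (suc m))) (≈-trans (gauss-r0 (suc (suc m))) (≈-sym (gauss-r0 (suc m)))))) ⟩
    u (+ suc a) ⊛ gauss 0 (suc m) +ₛ (antidiagonal (λ r s → H r (suc s) +ₛ Q r s) m +ₛ H (suc m) 0)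
      ≈⟨ +ₛ-congˡ (u (+ suc a) ⊛ gauss 0 (suc m)) (+ₛ-congʳ (H (suc m) 0) (antidiagonal-+ m (λ r s → H r (suc s)) Q)) ⟩
    u (+ suc a) ⊛ gauss 0 (suc m) +ₛ ((antidiagonal (λ r s → H r (suc s)) m +ₛ antidiagonal Q m) +ₛ H (suc m) 0)
      ≈⟨ solve 4 (λ x y z t → x :+ ((y :+ z) :+ t) := (y :+ t) :+ (x :+ z)) ≈-refl
               (u (+ suc a) ⊛ gauss 0 (suc m)) (antidiagonal (λ r s → H r (suc s)) m) (antidiagonal Q m) (H (suc m) 0) ⟩
    (antidiagonal (λ r s → H r (suc s)) m +ₛ H (suc m) 0) +ₛ (u (+ suc a) ⊛ gauss 0 (suc m) +ₛ antidiagonal Q m)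
      ≈⟨ +ₛ-cong (≈-sym (antidiagonal-last m H))
                 (+ₛ-congʳ (antidiagonal Q m) (⊛-congʳ (gauss 0 (suc m)) (≈-sym (*-identityˡ (u (+ suc a)))))) ⟩
    jacobiSum u a b +ₛ antidiagonal (λ r s → (q^ r ⊛ u (diff (suc a) r)) ⊛ gauss r s) (suc m) ∎
    where
    m : ℕ
    m = a ℕ.+ b
    H : ℕ → ℕ → Series
    H r s = u (diff a r) ⊛ gauss r s
    Q : ℕ → ℕ → Series
    Q r s = (q^ suc r ⊛ u (diff a r)) ⊛ gauss (suc r) s
    pascal : ∀ r s → u (diff a r) ⊛ gauss (suc r) (suc s) ≈ H r (suc s) +ₛ Q r s
    pascal r s = ≈-trans (⊛-congˡ (u (diff a r)) (gauss-pascal r s))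
      (solve 4 (λ U B x B′ → U :* (B :+ x :* B′) := U :* B :+ (x :* U) :* B′) ≈-refl
         (u (diff a r)) (gauss r (suc s)) (q^ suc r) (gauss (suc r) s))

  triMono-shift : ∀ c c⁺ → (∀ k → c (k + 1ℤ) ≡ - c⁺ k) → ∀ a r →
                  q^ r ⊛ triMono c (diff (suc a) r) ≈ -ₛ (q^ suc a ⊛ triMono c⁺ (diff a r))
  triMono-shift c c⁺ c-suc a r = begin
    q^ r ⊛ (κ (c (diff (suc a) r)) ⊛ q^ tri (diff (suc a) r))
      ≈⟨ solve 3 (λ x C y → x :* (C :* y) := C :* (x :* y)) ≈-refl (q^ r) (κ (c (diff (suc a) r))) (q^ tri (diff (suc a) r)) ⟩
    κ (c (diff (suc a) r)) ⊛ (q^ r ⊛ q^ tri (diff (suc a) r))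
      ≈⟨ ⊛-cong (reflexive (cong κ (trans (cong c (diff-suc a r)) (c-suc k)))) (mono-+ r (tri (diff (suc a) r))) ⟩
    κ (- c⁺ k) ⊛ q^ (r ℕ.+ tri (diff (suc a) r))
      ≈⟨ ⊛-cong (κ-neg (c⁺ k)) (≈-trans (reflexive (cong q^_ (tri-diff-step a r))) (≈-sym (mono-+ (suc a) (tri k)))) ⟩
    (-ₛ κ (c⁺ k)) ⊛ (q^ suc a ⊛ q^ tri k)
      ≈⟨ solve 3 (λ x C y → (:- C) :* (x :* y) := :- (x :* (C :* y))) ≈-refl (q^ suc a) (κ (c⁺ k)) (q^ tri k) ⟩
    -ₛ (q^ suc a ⊛ triMono c⁺ k) ∎
    where k : ℤ
          k = diff a r

  jacobiSum-step : ∀ c c⁺ → (∀ k → c (k + 1ℤ) ≡ - c⁺ k) → ∀ a b →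
    jacobiSum (triMono c) (suc a) b ≈ jacobiSum (triMono c) a b -ₛ q^ suc a ⊛ jacobiSum (triMono c⁺) a b
  jacobiSum-step c c⁺ c-suc a b = ≈-trans (jacobiSum-suc (triMono c) a b) (+ₛ-congˡ (jacobiSum (triMono c) a b) (begin
    antidiagonal (λ r s → (q^ r ⊛ triMono c (diff (suc a) r)) ⊛ gauss r s) n
      ≈⟨ antidiagonal-cong n (λ r s → (q^ r ⊛ triMono c (diff (suc a) r)) ⊛ gauss r s)
                             (λ r s → (-ₛ q^ suc a) ⊛ (triMono c⁺ (diff a r) ⊛ gauss r s)) (λ r _ → ≈-trans (⊛-congʳ (gauss r (n ℕ.∸ r)) (triMono-shift c c⁺ c-suc a r))
            (solve 3 (λ x t B → (:- (x :* t)) :* B := (:- x) :* (t :* B)) ≈-refl (q^ suc a) (triMono c⁺ (diff a r)) (gauss r (n ℕ.∸ r)))) ⟩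
    antidiagonal (λ r s → (-ₛ q^ suc a) ⊛ (triMono c⁺ (diff a r) ⊛ gauss r s)) n
      ≈⟨ antidiagonal-scale n (-ₛ q^ suc a) (λ r s → triMono c⁺ (diff a r) ⊛ gauss r s) ⟩
    (-ₛ q^ suc a) ⊛ jacobiSum (triMono c⁺) a b
      ≈⟨ solve 2 (λ x S → (:- x) :* S := :- (x :* S)) ≈-refl (q^ suc a) (jacobiSum (triMono c⁺) a b) ⟩
    -ₛ (q^ suc a ⊛ jacobiSum (triMono c⁺) a b) ∎))
    where n : ℕ
          n = suc (a ℕ.+ b)

  jacobiSum-linear : ∀ c e m a b → jacobiSum (triMono (λ k → c k + m * e k)) a b ≈
                                   jacobiSum (triMono c) a b +ₛ κ m ⊛ jacobiSum (triMono e) a b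
  jacobiSum-linear c e m a b = begin
    antidiagonal (λ r s → triMono (λ k → c k + m * e k) (diff a r) ⊛ gauss r s) n
      ≈⟨ antidiagonal-cong n (λ r s → triMono (λ k → c k + m * e k) (diff a r) ⊛ gauss r s)
                             (λ r s → triMono c (diff a r) ⊛ gauss r s +ₛ κ m ⊛ (triMono e (diff a r) ⊛ gauss r s))
                             (λ r _ → term (diff a r) (gauss r (n ℕ.∸ r))) ⟩
    antidiagonal (λ r s → triMono c (diff a r) ⊛ gauss r s +ₛ κ m ⊛ (triMono e (diff a r) ⊛ gauss r s)) n
      ≈⟨ antidiagonal-+ n (λ r s → triMono c (diff a r) ⊛ gauss r s) (λ r s → κ m ⊛ (triMono e (diff a r) ⊛ gauss r s)) ⟩
    jacobiSum (triMono c) a b +ₛ antidiagonal (λ r s → κ m ⊛ (triMono e (diff a r) ⊛ gauss r s)) n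
      ≈⟨ +ₛ-congˡ (jacobiSum (triMono c) a b) (antidiagonal-scale n (κ m) (λ r s → triMono e (diff a r) ⊛ gauss r s)) ⟩
    jacobiSum (triMono c) a b +ₛ κ m ⊛ jacobiSum (triMono e) a b ∎
    where
    n : ℕ
    n = suc (a ℕ.+ b)
    term : ∀ k B → triMono (λ k → c k + m * e k) k ⊛ B ≈ triMono c k ⊛ B +ₛ κ m ⊛ (triMono e k ⊛ B)
    term k B = ≈-trans (⊛-congʳ B (⊛-congʳ (q^ tri k) (≈-trans (κ-+ (c k) (m * e k)) (+ₛ-congˡ (κ (c k)) (κ-* m (e k))))))
      (solve 5 (λ C M F x B → ((C :+ M :* F) :* x) :* B := (C :* x) :* B :+ M :* ((F :* x) :* B)) ≈-refl
         (κ (c k)) (κ m) (κ (e k)) (q^ tri k) B)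

  -- If c(-k-1) = ε c(k), reading the sum backwards exchanges a and b.
  jacobiSum-reflect : ∀ c ε → (∀ k → c (- k - 1ℤ) ≡ ε * c k) → ∀ a b →
                      jacobiSum (triMono c) a b ≈ κ ε ⊛ jacobiSum (triMono c) b a
  jacobiSum-reflect c ε c-reflect a b = begin
    jacobiSum (triMono c) a b
      ≈⟨ antidiagonal-swap n (λ r s → triMono c (diff a r) ⊛ gauss r s) ⟩
    antidiagonal (λ r s → triMono c (diff a s) ⊛ gauss s r) n
      ≈⟨ antidiagonal-cong n (λ r s → triMono c (diff a s) ⊛ gauss s r) (λ r s → κ ε ⊛ (triMono c (diff b r) ⊛ gauss r s))
                             (λ r r≤n → term r (n ℕ.∸ r) (ℕP.m+[n∸m]≡n r≤n)) ⟩
    antidiagonal (λ r s → κ ε ⊛ (triMono c (diff b r) ⊛ gauss r s)) n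
      ≈⟨ antidiagonal-scale n (κ ε) (λ r s → triMono c (diff b r) ⊛ gauss r s) ⟩
    κ ε ⊛ antidiagonal (λ r s → triMono c (diff b r) ⊛ gauss r s) n
      ≈⟨ ⊛-congˡ (κ ε) (reflexive (cong (λ z → antidiagonal (λ r s → triMono c (diff b r) ⊛ gauss r s) (suc z)) (ℕP.+-comm a b))) ⟩
    κ ε ⊛ jacobiSum (triMono c) b a ∎
    where
    n : ℕ
    n = suc (a ℕ.+ b)
    triMono-reflect : ∀ k → triMono c (- k - 1ℤ) ≈ κ ε ⊛ triMono c k
    triMono-reflect k = begin
      κ (c (- k - 1ℤ)) ⊛ q^ tri (- k - 1ℤ) ≈⟨ ⊛-cong (≈-trans (reflexive (cong κ (c-reflect k))) (κ-* ε (c k)))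
                                                     (reflexive (cong q^_ (tri-reflect k))) ⟩
      (κ ε ⊛ κ (c k)) ⊛ q^ tri k           ≈⟨ *-assoc (κ ε) (κ (c k)) (q^ tri k) ⟩
      κ ε ⊛ triMono c k                    ∎
    term : ∀ r s → r ℕ.+ s ≡ n → triMono c (diff a s) ⊛ gauss s r ≈ κ ε ⊛ (triMono c (diff b r) ⊛ gauss r s)
    term r s r+s≡n = begin
      triMono c (diff a s) ⊛ gauss s r             ≈⟨ ⊛-cong (reflexive (cong (triMono c) (diff-reflect a b r s r+s≡n))) (gauss-sym s r) ⟩
      triMono c (- diff b r - 1ℤ) ⊛ gauss r s      ≈⟨ ⊛-congʳ (gauss r s) (triMono-reflect (diff b r)) ⟩
      (κ ε ⊛ triMono c (diff b r)) ⊛ gauss r s     ≈⟨ *-assoc (κ ε) (triMono c (diff b r)) (gauss r s) ⟩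
      κ ε ⊛ (triMono c (diff b r) ⊛ gauss r s)     ∎

  -- Both are proved together by induction on a (jacobiSum-step), the case
  -- a = 0 being reduced to b = 0 by the reflection symmetry.

  FiniteJacobi : ℕ → ℕ → Set
  FiniteJacobi a b = jacobiSum (triMono sgn) a b ≈ 0ₛ
                   × jacobiSum (triMono weight) a b ≈ κ (+ 2) ⊛ (E a ⊛ E b)

  private
    gauss-01 : gauss 0 1 ≈ κ 1ℤ
    gauss-01 = ≈-trans (gauss-0s 1) (≈-sym κ-one)

    gauss-10 : gauss 1 0 ≈ κ 1ℤ
    gauss-10 = ≈-trans (gauss-r0 1) (≈-sym κ-one)

  finiteJacobi-00 : FiniteJacobi 0 0
  finiteJacobi-00 = sgn-sum , weight-sum
    where
    sgn-sum : jacobiSum (triMono sgn) 0 0 ≈ 0ₛ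
    sgn-sum = begin
      (κ 1ℤ ⊛ one) ⊛ gauss 0 1 +ₛ ((κ (- 1ℤ) ⊛ one) ⊛ gauss 1 0 +ₛ 0ₛ)
        ≈⟨ +ₛ-cong (⊛-cong (⊛-congˡ (κ 1ℤ) (≈-sym κ-one)) gauss-01)
                   (+ₛ-cong (⊛-cong (⊛-congˡ (κ (- 1ℤ)) (≈-sym κ-one)) gauss-10) (≈-sym κ-zero)) ⟩
      (κ 1ℤ ⊛ κ 1ℤ) ⊛ κ 1ℤ +ₛ ((κ (- 1ℤ) ⊛ κ 1ℤ) ⊛ κ 1ℤ +ₛ κ 0ℤ)
        ≈⟨ solve 0 ((con 1ℤ :* con 1ℤ) :* con 1ℤ :+ ((con (- 1ℤ) :* con 1ℤ) :* con 1ℤ :+ con 0ℤ) := con 0ℤ) ≈-refl ⟩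
      κ 0ℤ
        ≈⟨ κ-zero ⟩
      0ₛ ∎
    weight-sum : jacobiSum (triMono weight) 0 0 ≈ κ (+ 2) ⊛ (E 0 ⊛ E 0)
    weight-sum = begin
      (κ 1ℤ ⊛ one) ⊛ gauss 0 1 +ₛ ((κ 1ℤ ⊛ one) ⊛ gauss 1 0 +ₛ 0ₛ)
        ≈⟨ +ₛ-cong (⊛-cong (⊛-congˡ (κ 1ℤ) (≈-sym κ-one)) gauss-01)
                   (+ₛ-cong (⊛-cong (⊛-congˡ (κ 1ℤ) (≈-sym κ-one)) gauss-10) (≈-sym κ-zero)) ⟩
      (κ 1ℤ ⊛ κ 1ℤ) ⊛ κ 1ℤ +ₛ ((κ 1ℤ ⊛ κ 1ℤ) ⊛ κ 1ℤ +ₛ κ 0ℤ)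
        ≈⟨ solve 0 ((con 1ℤ :* con 1ℤ) :* con 1ℤ :+ ((con 1ℤ :* con 1ℤ) :* con 1ℤ :+ con 0ℤ) := con (+ 2) :* (con 1ℤ :* con 1ℤ)) ≈-refl ⟩
      κ (+ 2) ⊛ (κ 1ℤ ⊛ κ 1ℤ)
        ≈⟨ ⊛-congˡ (κ (+ 2)) (⊛-cong κ-one κ-one) ⟩
      κ (+ 2) ⊛ (E 0 ⊛ E 0) ∎

  finiteJacobi-step : ∀ a b → FiniteJacobi a b → FiniteJacobi (suc a) b
  finiteJacobi-step a b (sgn-sum , weight-sum) = sgn-sum′ , weight-sum′
    where
    x : Series
    x = q^ suc a
    sgn-sum′ : jacobiSum (triMono sgn) (suc a) b ≈ 0ₛ
    sgn-sum′ = begin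
      jacobiSum (triMono sgn) (suc a) b                          ≈⟨ jacobiSum-step sgn sgn sgn-suc a b ⟩
      jacobiSum (triMono sgn) a b -ₛ x ⊛ jacobiSum (triMono sgn) a b ≈⟨ +ₛ-cong sgn-sum (-‿cong (≈-trans (⊛-congˡ x sgn-sum) (zeroʳ x))) ⟩
      0ₛ -ₛ 0ₛ                                                   ≈⟨ -‿inverseʳ 0ₛ ⟩
      0ₛ                                                         ∎
    weight-sum′ : jacobiSum (triMono weight) (suc a) b ≈ κ (+ 2) ⊛ (E (suc a) ⊛ E b)
    weight-sum′ = begin
      jacobiSum (triMono weight) (suc a) b
        ≈⟨ jacobiSum-step weight (λ k → weight k + + 2 * sgn k) weight-suc a b ⟩
      jacobiSum (triMono weight) a b -ₛ x ⊛ jacobiSum (triMono (λ k → weight k + + 2 * sgn k)) a b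
        ≈⟨ +ₛ-congˡ (jacobiSum (triMono weight) a b) (-‿cong (⊛-congˡ x (jacobiSum-linear weight sgn (+ 2) a b))) ⟩
      jacobiSum (triMono weight) a b -ₛ x ⊛ (jacobiSum (triMono weight) a b +ₛ κ (+ 2) ⊛ jacobiSum (triMono sgn) a b)
        ≈⟨ +ₛ-cong weight-sum (-‿cong (⊛-congˡ x (≈-trans (+ₛ-cong weight-sum (≈-trans (⊛-congˡ (κ (+ 2)) sgn-sum) (zeroʳ (κ (+ 2)))))
                                                          (+-identityʳ (κ (+ 2) ⊛ (E a ⊛ E b)))))) ⟩
      κ (+ 2) ⊛ (E a ⊛ E b) -ₛ x ⊛ (κ (+ 2) ⊛ (E a ⊛ E b))
        ≈⟨ solve 4 (λ C A B x → C :* (A :* B) :- x :* (C :* (A :* B)) := C :* ((A :* (con 1ℤ :- x)) :* B))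
                 ≈-refl (κ (+ 2)) (E a) (E b) x ⟩
      κ (+ 2) ⊛ ((E a ⊛ (κ 1ℤ -ₛ x)) ⊛ E b)
        ≈⟨ ⊛-congˡ (κ (+ 2)) (⊛-congʳ (E b) (⊛-congˡ (E a) (≈-sym (euler-factor a)))) ⟩
      κ (+ 2) ⊛ (E (suc a) ⊛ E b) ∎

  finiteJacobi-swap : ∀ a b → FiniteJacobi b a → FiniteJacobi a b
  finiteJacobi-swap a b (sgn-sum , weight-sum) =
    ≈-trans (jacobiSum-reflect sgn (- 1ℤ) sgn-reflect a b) (≈-trans (⊛-congˡ (κ (- 1ℤ)) sgn-sum) (zeroʳ (κ (- 1ℤ)))) ,
    ≈-trans (jacobiSum-reflect weight 1ℤ weight-reflect a b) (≈-trans (⊛-congˡ (κ 1ℤ) weight-sum)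
      (solve 3 (λ C A B → con 1ℤ :* (C :* (B :* A)) := C :* (A :* B)) ≈-refl (κ (+ 2)) (E a) (E b)))

  finiteJacobi : ∀ a b → FiniteJacobi a b
  finiteJacobi zero    b = finiteJacobi-swap 0 b (row b)
    where
    row : ∀ a → FiniteJacobi a 0
    row zero    = finiteJacobi-00
    row (suc a) = finiteJacobi-step a 0 (row a)
  finiteJacobi (suc a) b = finiteJacobi-step a b (finiteJacobi a b)

  -- Passing to the limit.  Modulo q^(M+1) the factors (1 - q^k) and
  -- 1/(1 - q^k) with k > M are 1, so (q;q)_n and 1/(q;q)_n stabilise for
  -- n ≥ M, and every term of exponent > M vanishes.

  euler-factor-high : ∀ k → M < k → eulerFactor k ≈ one
  euler-factor-high k M<k = mk≈ coefficient
    where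
    coefficient : ∀ i → i ≤ M → eulerFactor k i ≡ one i [mod d ]
    coefficient zero    _   = mod-refl
    coefficient (suc j) j<M with k ℕ.≟ suc j
    ... | yes k≡j = ⊥-elim (ℕP.<⇒≱ M<k (subst (_≤ M) (sym k≡j) j<M))
    ... | no _    = mod-refl

  geometric-high : ∀ k → M < k → geomFactor k ≈ one
  geometric-high k M<k = mk≈ λ i i≤M → ≡⇒≡mod (geometric-below k i (ℕP.≤-<-trans i≤M M<k))

  product-stable : ∀ f → (∀ k → M < k → f k ≈ one) → ∀ n → M ≤ n → prodUpTo f n ≈ prodUpTo f M
  product-stable f high n M≤n = ≈-trans (reflexive (cong (prodUpTo f) (sym (ℕP.m+[n∸m]≡n M≤n)))) (beyond (n ℕ.∸ M))
    where
    beyond : ∀ e → prodUpTo f (M ℕ.+ e) ≈ prodUpTo f M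
    beyond zero    = reflexive (cong (prodUpTo f) (ℕP.+-identityʳ M))
    beyond (suc e) = begin
      prodUpTo f (M ℕ.+ suc e)             ≡⟨ cong (prodUpTo f) (ℕP.+-suc M e) ⟩
      prodUpTo f (M ℕ.+ e) ⊛ f (suc (M ℕ.+ e)) ≈⟨ ⊛-cong (beyond e) (high (suc (M ℕ.+ e)) (s≤s (ℕP.m≤m+n M e))) ⟩
      prodUpTo f M ⊛ one                   ≈⟨ *-identityʳ (prodUpTo f M) ⟩
      prodUpTo f M                         ∎

  E-stable : ∀ n → M ≤ n → E n ≈ E M
  E-stable = product-stable eulerFactor euler-factor-high

  G-stable : ∀ n → M ≤ n → G n ≈ G M
  G-stable = product-stable geomFactor geometric-high

  triMono-high : ∀ c k → M < tri k → triMono c k ≈ 0ₛ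
  triMono-high c k M<tri = ≈-trans (⊛-congˡ (κ (c k)) (mk≈ λ i i≤M → ≡⇒≡mod (mono-below (tri k) i (ℕP.≤-<-trans i≤M M<tri))))
                                   (zeroʳ (κ (c k)))

  -- Jacobi's identity: the truncated bilateral series
  --   Σ_{k=-2M-1}^{2M} (2k+1)(-1)^k q^(k(k+1)/2)   equals   2 (q;q)_∞^3  modulo q^(M+1).
  -- It is the finite identity for a = b = 2M: every term with r < M or s < M
  -- has exponent > M, and the others have [r+s choose r] = 1/(q;q)_M.

  jacobiSeries : Series
  jacobiSeries = antidiagonal (λ r _ → triMono weight (diff (M ℕ.+ M) r)) (suc ((M ℕ.+ M) ℕ.+ (M ℕ.+ M)))

  jacobiSeries-G : G M ⊛ jacobiSeries ≈ κ (+ 2) ⊛ (E M ⊛ E M)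
  jacobiSeries-G = begin
    G M ⊛ jacobiSeries
      ≈⟨ ≈-sym (antidiagonal-scale N (G M) (λ r _ → t r)) ⟩
    antidiagonal (λ r _ → G M ⊛ t r) N
      ≈⟨ ≈-sym (antidiagonal-cong N (λ r s → t r ⊛ gauss r s) (λ r _ → G M ⊛ t r) (λ r r≤N → term r (N ℕ.∸ r) (ℕP.m+[n∸m]≡n r≤N))) ⟩
    jacobiSum (triMono weight) A A
      ≈⟨ proj₂ (finiteJacobi A A) ⟩
    κ (+ 2) ⊛ (E A ⊛ E A)
      ≈⟨ ⊛-congˡ (κ (+ 2)) (⊛-cong (E-stable A (ℕP.m≤m+n M M)) (E-stable A (ℕP.m≤m+n M M))) ⟩
    κ (+ 2) ⊛ (E M ⊛ E M) ∎
    where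
    A N : ℕ
    A = M ℕ.+ M
    N = suc (A ℕ.+ A)
    t : ℕ → Series
    t r = triMono weight (diff A r)
    vanishing : ∀ r s → M < tri (diff A r) → t r ⊛ gauss r s ≈ G M ⊛ t r
    vanishing r s far = begin
      t r ⊛ gauss r s  ≈⟨ ⊛-congʳ (gauss r s) (triMono-high weight (diff A r) far) ⟩
      0ₛ ⊛ gauss r s   ≈⟨ zeroˡ (gauss r s) ⟩
      0ₛ               ≈⟨ ≈-sym (zeroʳ (G M)) ⟩
      G M ⊛ 0ₛ         ≈⟨ ⊛-congˡ (G M) (≈-sym (triMono-high weight (diff A r) far)) ⟩
      G M ⊛ t r        ∎
    term : ∀ r s → r ℕ.+ s ≡ N → t r ⊛ gauss r s ≈ G M ⊛ t r
    term r s r+s≡N with M ℕ.≤? r | M ℕ.≤? s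
    ... | no r<M | _      = vanishing r s (far-exponent M r (ℕP.≰⇒> r<M))
    ... | yes _  | no s<M = vanishing r s (subst (M <_) reflected (far-exponent M s (ℕP.≰⇒> s<M)))
      where
      reflected : tri (diff A s) ≡ tri (diff A r)
      reflected = trans (cong tri (diff-reflect A A r s r+s≡N)) (tri-reflect (diff A r))
    ... | yes M≤r | yes M≤s = begin
      t r ⊛ gauss r s                ≈⟨ ⊛-congˡ (t r) (⊛-cong (⊛-cong (G-stable r M≤r) (G-stable s M≤s))
                                                              (E-stable (r ℕ.+ s) (ℕP.≤-trans M≤r (ℕP.m≤m+n r s)))) ⟩
      t r ⊛ ((G M ⊛ G M) ⊛ E M)      ≈⟨ ⊛-congˡ (t r) (≈-trans (*-assoc (G M) (G M) (E M)) (≈-trans (⊛-congˡ (G M) (G⊛E M)) (*-identityʳ (G M)))) ⟩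
      t r ⊛ G M                      ≈⟨ *-comm (t r) (G M) ⟩
      G M ⊛ t r                      ∎

  jacobi-identity : jacobiSeries ≈ κ (+ 2) ⊛ E M ^ₛ 3
  jacobi-identity = begin
    jacobiSeries                              ≈⟨ ≈-sym (*-identityˡ jacobiSeries) ⟩
    one ⊛ jacobiSeries                        ≈⟨ ⊛-congʳ jacobiSeries (≈-sym (≈-trans (*-comm (E M) (G M)) (G⊛E M))) ⟩
    (E M ⊛ G M) ⊛ jacobiSeries                ≈⟨ *-assoc (E M) (G M) jacobiSeries ⟩
    E M ⊛ (G M ⊛ jacobiSeries)                ≈⟨ ⊛-congˡ (E M) jacobiSeries-G ⟩
    E M ⊛ (κ (+ 2) ⊛ (E M ⊛ E M))             ≈⟨ solve 2 (λ C X → X :* (C :* (X :* X)) := C :* (X :* (X :* X))) ≈-refl (κ (+ 2)) (E M) ⟩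
    κ (+ 2) ⊛ (E M ⊛ (E M ⊛ E M))             ≈⟨ ⊛-congˡ (κ (+ 2)) (⊛-congˡ (E M) (⊛-congˡ (E M) (≈-sym (*-identityʳ (E M))))) ⟩
    κ (+ 2) ⊛ E M ^ₛ 3                        ∎

conv-vanishes : ∀ {d} n a b → (∀ i → i ≤ n → a i * b (n ℕ.∸ i) ≡ 0ℤ [mod d ]) → (a ⊛ b) n ≡ 0ℤ [mod d ]
conv-vanishes zero    a b terms = mod-+ (terms 0 z≤n) mod-refl
conv-vanishes (suc n) a b terms = mod-trans (≡⇒≡mod (conv-suc a b n))
  (mod-+ (terms 0 z≤n) (conv-vanishes n (tail a) b (λ i i≤n → terms (suc i) (s≤s i≤n))))

times-zeroˡ : ∀ {d x} y → x ≡ 0ℤ [mod d ] → x * y ≡ 0ℤ [mod d ]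
times-zeroˡ y x≡0 = mod-trans (mod-* x≡0 (mod-refl {a = y})) (≡⇒≡mod (ℤP.*-zeroˡ y))

times-zeroʳ : ∀ {d} x {y} → y ≡ 0ℤ [mod d ] → x * y ≡ 0ℤ [mod d ]
times-zeroʳ x y≡0 = mod-trans (mod-* (mod-refl {a = x}) y≡0) (≡⇒≡mod (ℤP.*-zeroʳ x))

residue-sub : ∀ i j → j % 5 ≡ 0 → j ≤ i → (i ℕ.∸ j) % 5 ≡ i % 5
residue-sub i j j%5≡0 j≤i with ℕD.m%n≡0⇒n∣m j 5 j%5≡0
... | ℕD.divides q refl = m*n≤o⇒[o∸m*n]%n≡o%n q j≤i

-- If k(k+1)/2 ≡ 2, 3, 4 (mod 5) then in fact k(k+1)/2 ≡ 3 and k ≡ 2 (mod 5),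
-- so 5 divides 2k+1.  Both residues are periodic with period 5.
triangle-residue : ∀ n → 2 ≤ triangle n % 5 → (2 ℕ.* n ℕ.+ 1) % 5 ≡ 0
triangle-residue 0 ()
triangle-residue 1 (s≤s ())
triangle-residue 2 _ = refl
triangle-residue 3 (s≤s ())
triangle-residue 4 ()
triangle-residue (suc (suc (suc (suc (suc n))))) high =
  trans (cong (_% 5) (odd-period n)) (trans ([m+kn]%n≡m%n (2 ℕ.* n ℕ.+ 1) 2 5)
    (triangle-residue n (subst (2 ≤_) (trans (cong (_% 5) (triangle-period n (triangle n)))
                                              ([m+kn]%n≡m%n (triangle n) (n ℕ.+ 3) 5)) high)))
  where
  odd-period : ∀ n → 2 ℕ.* (5 ℕ.+ n) ℕ.+ 1 ≡ (2 ℕ.* n ℕ.+ 1) ℕ.+ 2 ℕ.* 5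
  odd-period = ℕSolver.solve-∀
  triangle-period : ∀ n t → (5 ℕ.+ n) ℕ.+ ((4 ℕ.+ n) ℕ.+ ((3 ℕ.+ n) ℕ.+ ((2 ℕ.+ n) ℕ.+ ((1 ℕ.+ n) ℕ.+ t))))
                            ≡ t ℕ.+ (n ℕ.+ 3) ℕ.* 5
  triangle-period = ℕSolver.solve-∀

odd-divisible : ∀ n → 2 ≤ triangle n % 5 → + 5 ∣ˢ (+ 2 * + n + 1ℤ)
odd-divisible n high = subst (+ 5 ∣ˢ_) as-integer
  (Signed.∣ᵤ⇒∣ (ℕD.m%n≡0⇒n∣m (2 ℕ.* n ℕ.+ 1) 5 (triangle-residue n high)))
  where
  as-integer : + (2 ℕ.* n ℕ.+ 1) ≡ + 2 * + n + 1ℤ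
  as-integer = trans (ℤP.pos-+ (2 ℕ.* n) 1) (cong (_+ 1ℤ) (ℤP.pos-* 2 n))

weight-vanishes : ∀ k → 2 ≤ tri k % 5 → weight k ≡ 0ℤ [mod + 5 ]
weight-vanishes (+ n) high =
  congruent (subst (+ 5 ∣ˢ_) (sym (ℤP.+-identityʳ (weight (+ n)))) (∣m⇒∣m*n (altN n) (odd-divisible n high)))
weight-vanishes -[1+ n ] high =
  congruent (subst (+ 5 ∣ˢ_) (sym (trans (ℤP.+-identityʳ (weight -[1+ n ])) (cong (_* altN (suc n)) reflected)))
                   (∣m⇒∣m*n (altN (suc n)) (∣m⇒∣-m (odd-divisible n high))))
  where
  lemma : ∀ x → + 2 * (- x - 1ℤ) + 1ℤ ≡ - (+ 2 * x + 1ℤ)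
  lemma = solve-∀
  reflected : + 2 * -[1+ n ] + 1ℤ ≡ - (+ 2 * + n + 1ℤ)
  reflected = trans (cong (λ z → + 2 * z + 1ℤ) (negsuc-is-sub n)) (lemma (+ n))

module ModFive (M : ℕ) where
  open Truncated (+ 5) M

  five≈0 : κ (+ 5) ≈ 0ₛ
  five≈0 = mk≈ λ { zero _ → congruent (divides 1ℤ refl) ; (suc i) _ → mod-refl }

  frobenius : ∀ x → (κ 1ℤ -ₛ x) ^ₛ 5 ≈ κ 1ℤ -ₛ x ^ₛ 5
  frobenius x = begin
    (κ 1ℤ -ₛ x) ^ₛ 5               ≈⟨ solve 1 (λ x → (con 1ℤ :- x) :^ 5 :=
                                                   con 1ℤ :- x :^ 5 :+ con (+ 5) :* (x :^ 4 :- con (+ 2) :* x :^ 3 :+ con (+ 2) :* x :^ 2 :- x))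
                                            ≈-refl x ⟩
    κ 1ℤ -ₛ x ^ₛ 5 +ₛ κ (+ 5) ⊛ Y  ≈⟨ +ₛ-congˡ (κ 1ℤ -ₛ x ^ₛ 5) (≈-trans (⊛-congʳ Y five≈0) (zeroˡ Y)) ⟩
    κ 1ℤ -ₛ x ^ₛ 5 +ₛ 0ₛ           ≈⟨ +-identityʳ (κ 1ℤ -ₛ x ^ₛ 5) ⟩
    κ 1ℤ -ₛ x ^ₛ 5                 ∎
    where Y : Series
          Y = x ^ₛ 4 -ₛ κ (+ 2) ⊛ x ^ₛ 3 +ₛ κ (+ 2) ⊛ x ^ₛ 2 -ₛ x

  euler-frobenius : ∀ k → eulerFactor (suc k) ^ₛ 5 ≈ eulerFactor (5 ℕ.* suc k)
  euler-frobenius k = begin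
    eulerFactor (suc k) ^ₛ 5   ≈⟨ pow-cong 5 (euler-factor k) ⟩
    (κ 1ℤ -ₛ q^ suc k) ^ₛ 5    ≈⟨ frobenius (q^ suc k) ⟩
    κ 1ℤ -ₛ (q^ suc k) ^ₛ 5    ≈⟨ +ₛ-congˡ (κ 1ℤ) (-‿cong (mono-power (suc k) 5)) ⟩
    κ 1ℤ -ₛ q^ (5 ℕ.* suc k)   ≈⟨ ≈-sym (euler-factor (k ℕ.+ 4 ℕ.* suc k)) ⟩
    eulerFactor (5 ℕ.* suc k)  ∎

  E₅ G₅ : ℕ → Series
  E₅ = prodUpTo (λ k → eulerFactor (5 ℕ.* k))
  G₅ = prodUpTo (λ k → geomFactor (5 ℕ.* k))

  E-frobenius : ∀ n → E n ^ₛ 5 ≈ E₅ n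
  E-frobenius zero    = one-power 5
  E-frobenius (suc n) = ≈-trans (pow-⊛ (E n) (eulerFactor (suc n)) 5) (⊛-cong (E-frobenius n) (euler-frobenius n))

  G-frobenius : ∀ n → G n ^ₛ 5 ≈ G₅ n
  G-frobenius n = inverse-unique
    (≈-trans (⊛-congˡ (G n ^ₛ 5) (≈-sym (E-frobenius n))) (pow-inverse (G n) (E n) 5 (G⊛E n)))
    (product-inverse (λ k → geomFactor (5 ℕ.* k)) (λ k → eulerFactor (5 ℕ.* k))
                     (λ k → geometric-inverse (k ℕ.+ 4 ℕ.* suc k)) n)

  -- Vanishing modulo 5 of the coefficients up to q^M whose exponent has a
  -- residue mod 5 satisfying P; Sparse series only have exponents ≡ 0.

  record VanishesOn (P : ℕ → Set) (a : Series) : Set where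
    constructor vanishing
    field at : ∀ i → i ≤ M → P (i % 5) → a i ≡ 0ℤ [mod + 5 ]
  open VanishesOn public

  Sparse : Series → Set
  Sparse = VanishesOn (_≢ 0)

  vanishes-≈ : ∀ {P a b} → a ≈ b → VanishesOn P a → VanishesOn P b
  vanishes-≈ a≈b van = vanishing λ i i≤M Pi → mod-trans (mod-sym (coeff a≈b i i≤M)) (at van i i≤M Pi)

  sparse-⊛ : ∀ {P a b} → Sparse a → VanishesOn P b → VanishesOn P (a ⊛ b)
  sparse-⊛ {P} {a} {b} a-sparse b-van = vanishing λ i i≤M Pi → conv-vanishes i a b (term i i≤M Pi)
    where
    term : ∀ i → i ≤ M → P (i % 5) → ∀ j → j ≤ i → a j * b (i ℕ.∸ j) ≡ 0ℤ [mod + 5 ]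
    term i i≤M Pi j j≤i with j % 5 ℕ.≟ 0
    ... | yes j%5≡0 = times-zeroʳ (a j) (at b-van (i ℕ.∸ j) (ℕP.≤-trans (ℕP.m∸n≤m i j) i≤M)
                                                 (subst P (sym (residue-sub i j j%5≡0 j≤i)) Pi))
    ... | no j%5≢0  = times-zeroˡ (b (i ℕ.∸ j)) (at a-sparse j (ℕP.≤-trans j≤i i≤M) j%5≢0)

  sparse-one : Sparse one
  sparse-one = vanishing λ { zero _ 0≢0 → ⊥-elim (0≢0 refl) ; (suc i) _ _ → mod-refl }

  sparse-power : ∀ {a} → Sparse a → ∀ m → Sparse (a ^ₛ m)
  sparse-power a-sparse zero    = sparse-one
  sparse-power a-sparse (suc m) = sparse-⊛ a-sparse (sparse-power a-sparse m)

  sparse-product : ∀ f → (∀ k → Sparse (f (suc k))) → ∀ n → Sparse (prodUpTo f n)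
  sparse-product f f-sparse zero    = sparse-one
  sparse-product f f-sparse (suc n) = sparse-⊛ (sparse-product f f-sparse n) (f-sparse n)

  sparse-E₅ : ∀ n → Sparse (E₅ n)
  sparse-E₅ = sparse-product (λ k → eulerFactor (5 ℕ.* k)) factor
    where
    coefficient : ∀ k i → i % 5 ≢ 0 → eulerFactor (5 ℕ.* suc k) i ≡ 0ℤ [mod + 5 ]
    coefficient k zero    0≢0 = ⊥-elim (0≢0 refl)
    coefficient k (suc i) i≢0 with 5 ℕ.* suc k ℕ.≟ suc i
    ... | yes 5k≡i = ⊥-elim (i≢0 (ℕD.n∣m⇒m%n≡0 (suc i) 5 (subst (5 ℕD.∣_) 5k≡i (ℕD.m∣m*n (suc k)))))
    ... | no _     = mod-refl
    factor : ∀ k → Sparse (eulerFactor (5 ℕ.* suc k))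
    factor k = vanishing λ i _ → coefficient k i

  sparse-G₅ : ∀ n → Sparse (G₅ n)
  sparse-G₅ = sparse-product (λ k → geomFactor (5 ℕ.* k)) factor
    where
    coefficient : ∀ k i → i % 5 ≢ 0 → geomFactor (5 ℕ.* suc k) i ≡ 0ℤ [mod + 5 ]
    coefficient k i i≢0 with 5 ℕ.* suc k ∣? i
    ... | yes 5k∣i = ⊥-elim (i≢0 (ℕD.n∣m⇒m%n≡0 i 5 (ℕD.∣-trans (ℕD.m∣m*n (suc k)) 5k∣i)))
    ... | no _     = mod-refl
    factor : ∀ k → Sparse (geomFactor (5 ℕ.* suc k))
    factor k = vanishing λ i _ → coefficient k i

  vanishes-+ : ∀ {P a b} → VanishesOn P a → VanishesOn P b → VanishesOn P (a +ₛ b)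
  vanishes-+ a-van b-van = vanishing λ i i≤M Pi → mod-+ (at a-van i i≤M Pi) (at b-van i i≤M Pi)

  vanishes-sum : ∀ {P} n f → (∀ i → VanishesOn P (f i)) → VanishesOn P (sum f n)
  vanishes-sum zero    f f-van = vanishing λ _ _ _ → mod-refl
  vanishes-sum (suc n) f f-van = vanishes-+ (f-van 0) (vanishes-sum n (f ∘ suc) (f-van ∘ suc))

  vanishes-triMono : ∀ {P} c k → (P (tri k % 5) → c k ≡ 0ℤ [mod + 5 ]) → VanishesOn P (triMono c k)
  vanishes-triMono {P} c k c-van = vanishing λ i i≤M Pi →
    mod-trans (≡⇒≡mod (κ-conv (c k) (q^ tri k) i)) (coefficient i Pi (tri k ℕ.≟ i))
    where
    coefficient : ∀ i → P (i % 5) → Dec (tri k ≡ i) → c k * (q^ tri k) i ≡ 0ℤ [mod + 5 ]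
    coefficient i Pi (yes refl) = times-zeroˡ ((q^ tri k) (tri k)) (c-van Pi)
    coefficient i Pi (no k≢i)   = times-zeroʳ (c k) (≡⇒≡mod (mono-other (tri k) i k≢i))

  -- (q;q)^3 ≡ 3 · Σ (2k+1)(-1)^k q^(k(k+1)/2) has no terms of residue 2, 3, 4.
  cube-vanishes : VanishesOn (2 ≤_) (E M ^ₛ 3)
  cube-vanishes = vanishes-≈ cube≈3J
    (vanishing λ i i≤M Pi → mod-trans (≡⇒≡mod (κ-conv (+ 3) jacobiSeries i)) (times-zeroʳ (+ 3) (at J-vanishes i i≤M Pi)))
    where
    J-vanishes : VanishesOn (2 ≤_) jacobiSeries
    J-vanishes = vanishes-sum (suc (suc ((M ℕ.+ M) ℕ.+ (M ℕ.+ M)))) (λ r → triMono weight (diff (M ℕ.+ M) r)) (λ r → vanishes-triMono weight (diff (M ℕ.+ M) r) (weight-vanishes (diff (M ℕ.+ M) r)))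
    cube≈3J : κ (+ 3) ⊛ jacobiSeries ≈ E M ^ₛ 3
    cube≈3J = begin
      κ (+ 3) ⊛ jacobiSeries                  ≈⟨ ⊛-congˡ (κ (+ 3)) jacobi-identity ⟩
      κ (+ 3) ⊛ (κ (+ 2) ⊛ E M ^ₛ 3)          ≈⟨ solve 1 (λ X → con (+ 3) :* (con (+ 2) :* X) := X :+ con (+ 5) :* X) ≈-refl (E M ^ₛ 3) ⟩
      E M ^ₛ 3 +ₛ κ (+ 5) ⊛ E M ^ₛ 3          ≈⟨ +ₛ-congˡ (E M ^ₛ 3) (≈-trans (⊛-congʳ (E M ^ₛ 3) five≈0) (zeroˡ (E M ^ₛ 3))) ⟩
      E M ^ₛ 3 +ₛ 0ₛ                          ≈⟨ +-identityʳ (E M ^ₛ 3) ⟩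
      E M ^ₛ 3                                ∎

  euler-power-vanishes : ∀ μ → VanishesOn (2 ≤_) (E M ^ₛ (5 ℕ.* μ ℕ.+ 3))
  euler-power-vanishes μ = vanishes-≈ (≈-sym split) (sparse-⊛ (sparse-power (sparse-E₅ M) μ) cube-vanishes)
    where
    split : E M ^ₛ (5 ℕ.* μ ℕ.+ 3) ≈ E₅ M ^ₛ μ ⊛ E M ^ₛ 3
    split = ≈-trans (pow-+ (E M) (5 ℕ.* μ) 3) (⊛-congʳ (E M ^ₛ 3) (pow-multiple (E M) 5 (E-frobenius M) μ))

  partition-power-vanishes : ∀ μ → VanishesOn (2 ≤_) (G M ^ₛ (5 ℕ.* μ ℕ.+ 2))
  partition-power-vanishes μ = vanishes-≈ (≈-sym split) (sparse-⊛ (sparse-power (sparse-G₅ M) (suc μ)) cube-vanishes)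
    where
    Gᵐ : Series
    Gᵐ = G M ^ₛ (5 ℕ.* μ ℕ.+ 2)
    exponent : 5 ℕ.* μ ℕ.+ 2 ℕ.+ 3 ≡ 5 ℕ.* suc μ
    exponent = lemma μ
      where lemma : ∀ μ → 5 ℕ.* μ ℕ.+ 2 ℕ.+ 3 ≡ 5 ℕ.* (1 ℕ.+ μ)
            lemma = ℕSolver.solve-∀
    split : Gᵐ ≈ G₅ M ^ₛ suc μ ⊛ E M ^ₛ 3
    split = begin
      Gᵐ                                      ≈⟨ ≈-sym (*-identityʳ Gᵐ) ⟩
      Gᵐ ⊛ one                                ≈⟨ ⊛-congˡ Gᵐ (≈-sym (pow-inverse (G M) (E M) 3 (G⊛E M))) ⟩
      Gᵐ ⊛ (G M ^ₛ 3 ⊛ E M ^ₛ 3)              ≈⟨ ≈-sym (*-assoc Gᵐ (G M ^ₛ 3) (E M ^ₛ 3)) ⟩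
      (Gᵐ ⊛ G M ^ₛ 3) ⊛ E M ^ₛ 3              ≈⟨ ⊛-congʳ (E M ^ₛ 3) (≈-sym (pow-+ (G M) (5 ℕ.* μ ℕ.+ 2) 3)) ⟩
      G M ^ₛ (5 ℕ.* μ ℕ.+ 2 ℕ.+ 3) ⊛ E M ^ₛ 3  ≡⟨ cong (λ m → G M ^ₛ m ⊛ E M ^ₛ 3) exponent ⟩
      G M ^ₛ (5 ℕ.* suc μ) ⊛ E M ^ₛ 3         ≈⟨ ⊛-congʳ (E M ^ₛ 3) (pow-multiple (G M) 5 (G-frobenius M) (suc μ)) ⟩
      G₅ M ^ₛ suc μ ⊛ E M ^ₛ 3                ∎

p-euler-power : ∀ μ N → p (- (+ 5 * + μ + + 3)) N ≡ (E N ^ₛ (5 ℕ.* μ ℕ.+ 3)) N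
p-euler-power μ N = trans (cong (λ r → p r N) exponent) (cong (λ m → (E N ^ₛ m) N) (sym (ℕP.+-suc (5 ℕ.* μ) 2)))
  where
  exponent : - (+ 5 * + μ + + 3) ≡ -[1+ 5 ℕ.* μ ℕ.+ 2 ]
  exponent = trans (cong (λ z → - (z + + 3)) (sym (ℤP.pos-* 5 μ))) (cong (λ z → - (+ z)) (ℕP.+-suc (5 ℕ.* μ) 2))

p-partition-power : ∀ μ N → p (- (+ 5 * -[1+ μ ] + + 3)) N ≡ (G N ^ₛ (5 ℕ.* μ ℕ.+ 2)) N
p-partition-power μ N = cong (λ r → p r N) exponent
  where
  lemma : ∀ x → - (+ 5 * (- x - 1ℤ) + + 3) ≡ + 5 * x + + 2
  lemma = solve-∀
  exponent : - (+ 5 * -[1+ μ ] + + 3) ≡ + (5 ℕ.* μ ℕ.+ 2)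
  exponent = trans (cong (λ z → - (+ 5 * z + + 3)) (negsuc-is-sub μ))
                   (trans (lemma (+ μ)) (cong (_+ + 2) (sym (ℤP.pos-* 5 μ))))

p-vanishes : ∀ λ′ N → 2 ≤ N % 5 → p (- (+ 5 * λ′ + + 3)) N ≡ 0ℤ [mod + 5 ]
p-vanishes (+ μ) N high =
  subst (λ c → c ≡ 0ℤ [mod + 5 ]) (sym (p-euler-power μ N)) (at (euler-power-vanishes μ) N ℕP.≤-refl high)
  where open ModFive N
p-vanishes -[1+ μ ] N high =
  subst (λ c → c ≡ 0ℤ [mod + 5 ]) (sym (p-partition-power μ N)) (at (partition-power-vanishes μ) N ℕP.≤-refl high)
  where open ModFive N

residue : ∀ n ℓ → ℓ < 5 → (5 ℕ.* n ℕ.+ ℓ) % 5 ≡ ℓ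
residue n ℓ ℓ<5 = begin
  (5 ℕ.* n ℕ.+ ℓ) % 5  ≡⟨ cong (_% 5) (trans (ℕP.+-comm (5 ℕ.* n) ℓ) (cong (ℓ ℕ.+_) (ℕP.*-comm 5 n))) ⟩
  (ℓ ℕ.+ n ℕ.* 5) % 5  ≡⟨ [m+kn]%n≡m%n ℓ n 5 ⟩
  ℓ % 5                ≡⟨ m<n⇒m%n≡m ℓ<5 ⟩
  ℓ                    ∎
  where open P.≡-Reasoning

divisible : ∀ {c} → c ≡ 0ℤ [mod + 5 ] → (+ 5) ∣ c
divisible {c} (congruent 5∣c-0) = Signed.∣⇒∣ᵤ (subst (+ 5 ∣ˢ_) (ℤP.+-identityʳ c) 5∣c-0)

theorem1p2 : (λ′ : ℤ) (n ℓ : ℕ) → 2 ≤ ℓ → ℓ ≤ 4 →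
    (+ 5) ∣ p (- ((+ 5) *ℤ λ′ +ℤ (+ 3))) (5 *ℕ n +ℕ ℓ)
theorem1p2 λ′ n ℓ 2≤ℓ ℓ≤4 =
  divisible (p-vanishes λ′ (5 ℕ.* n ℕ.+ ℓ) (subst (2 ≤_) (sym (residue n ℓ (s≤s ℓ≤4))) 2≤ℓ))
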